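{- Let $\Xi$ be a finite set of variables. For each $m$ there is a number $q_m(\Xi)$ such that for every rooted structure $\mathfrak{S}$ all of whose interpreted variables lie in $\Xi$ and whose only interpreted first-order variable is $\mathrm{root}$, and every rooted structure $\mathfrak{S}_0$, we have $\mathfrak{S}_0+p\mathfrak{S}\equiv_m\mathfrak{S}_0+q\mathfrak{S}$ whenever $p,q\ge q_m(\Xi)$.
   Context: There are disjoint countable sets of first-order and second-order variables. A structure $\mathfrak{S}=(G,\sigma)$ consists of a finite simple undirected graph $G=(V,E)$ and a valuation $\sigma$: a partial map from first-order variables to $V$ and a partial map from second-order variables to subsets of $V$. $\mathfrak{S}[v/x]$ (resp. $\mathfrak{S}[U/X]$) denotes $\mathfrak{S}$ with the valuation changed so that $x\mapsto v$ (resp. $X\mapsto U$). Equivalence $\equiv_m$ is defined inductively: $\mathfrak{S}_1\equiv_0\mathfrak{S}_2$ if for every quantifier-free formula $\phi$ (built from atoms $x\in X$, $E(x,y)$ with Boolean connectives) whose free variables are all interpreted in both structures, $\mathfrak{S}_1\models\phi$ iff $\mathfrak{S}_2\models\phi$; $\mathfrak{S}_1\equiv_{m+1}\mathfrak{S}_2$ if for every first-order variable $x$, every $v_1\in V_1$ has some $v_2\in V_2$ with $\mathfrak{S}_1[v_1/x]\equiv_m\mathfrak{S}_2[v_2/x]$ and vice versa, and for every second-order variable $X$, every $U_1\subseteq V_1$ has some $U_2\subseteq V_2$ with $\mathfrak{S}_1[U_1/X]\equiv_m\mathfrak{S}_2[U_2/X]$ and vice versa. A structure is rooted if a distinguished first-order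 variable $\mathrm{root}$ is interpreted. For rooted $\mathfrak{S}_1,\mathfrak{S}_2$ with disjoint vertex sets whose interpreted first-order variables intersect exactly in $\{\mathrm{root}\}$, $\mathfrak{S}_1+\mathfrak{S}_2$ has vertex set $V_1\cup V_2$, edges $E_1\cup E_2\cup\{\{\sigma_1(\mathrm{root}),\sigma_2(\mathrm{root})\}\}$, $\sigma(X)=\sigma_1(X)\cup\sigma_2(X)$ if $X$ interpreted in both, $\sigma(X)=\sigma_i(X)$ if interpreted only in $\mathfrak{S}_i$, $\sigma(\mathrm{root})=\sigma_1(\mathrm{root})$, and $\sigma(x)=\sigma_i(x)$ for other first-order $x$ interpreted in $\mathfrak{S}_i$. For $\mathfrak{S}$ whose only interpreted first-order variable is $\mathrm{root}$, $\mathfrak{S}_0+0\mathfrak{S}=\mathfrak{S}_0$ and $\mathfrak{S}_0+(c+1)\mathfrak{S}=(\mathfrak{S}_0+c\mathfrak{S})+\mathfrak{S}'$, where $\mathfrak{S}'$ is an isomorphic copy of $\mathfrak{S}$ on fresh vertices; thus $c$ disjoint copies of $\mathfrak{S}$ are attached by edges from their roots to the root of $\mathfrak{S}_0$. -}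

module Defs where

open import Data.Nat using (ℕ; zero; suc; _+_; _≡ᵇ_)
open import Data.Bool using (Bool; true; false; _∧_; if_then_else_)
open import Data.Fin using (Fin; splitAt; _↑ˡ_; _↑ʳ_)
open import Data.Fin.Properties using () renaming (_≟_ to _≟ᶠ_)
open import Data.Maybe using (Maybe; just; nothing; map; Is-just; _<∣>_)
open import Data.Sum using (_⊎_; inj₁; inj₂; [_,_]′)
open import Data.Product using (Σ; ∃; _×_; _,_)
open import Data.List using (List; []; _∷_; _++_)
open import Data.List.Membership.Propositional using (_∈_)
open import Data.List.Relation.Unary.All using (All)
open import Relation.Binary.PropositionalEquality using (_≡_; refl)
open import Relation.Nullary using (¬_)
open import Relation.Nullary.Decidable using (⌊_⌋)

data Var : Set where
  fo : ℕ → Var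
  so : ℕ → Var

root : ℕ
root = 0

Subset : ℕ → Set
Subset n = Fin n → Bool

record Structure : Set where
  field
    size        : ℕ
    edge        : Fin size → Fin size → Bool
    edge-sym    : ∀ u v → edge u v ≡ edge v u
    edge-irrefl : ∀ v → edge v v ≡ false
    val₁        : ℕ → Maybe (Fin size)
    val₂        : ℕ → Maybe (Subset size)

open Structure public

_[_/₁_] : (S : Structure) → Fin (size S) → ℕ → Structure
S [ v /₁ x ] = record S { val₁ = λ y → if y ≡ᵇ x then just v else val₁ S y }

_[_/₂_] : (S : Structure) → Subset (size S) → ℕ → Structure
S [ U /₂ X ] = record S { val₂ = λ Y → if Y ≡ᵇ X then just U else val₂ S Y }

Interpreted : Structure → Var → Set
Interpreted S (fo x) = Is-just (val₁ S x)
Interpreted S (so X) = Is-just (val₂ S X)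

data QF : Set where
  mem  : ℕ → ℕ → QF
  adj  : ℕ → ℕ → QF
  neg  : QF → QF
  conj : QF → QF → QF
  disj : QF → QF → QF

freeVars : QF → List Var
freeVars (mem x X)  = fo x ∷ so X ∷ []
freeVars (adj x y)  = fo x ∷ fo y ∷ []
freeVars (neg φ)    = freeVars φ
freeVars (conj φ ψ) = freeVars φ ++ freeVars ψ
freeVars (disj φ ψ) = freeVars φ ++ freeVars ψ

_⊨_ : Structure → QF → Set
S ⊨ mem x X  = Σ (Fin (size S)) λ v → Σ (Subset (size S)) λ U →
                 val₁ S x ≡ just v × val₂ S X ≡ just U × U v ≡ true
S ⊨ adj x y  = Σ (Fin (size S)) λ u → Σ (Fin (size S)) λ v →
                 val₁ S x ≡ just u × val₁ S y ≡ just v × edge S u v ≡ true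
S ⊨ neg φ    = ¬ (S ⊨ φ)
S ⊨ conj φ ψ = (S ⊨ φ) × (S ⊨ ψ)
S ⊨ disj φ ψ = (S ⊨ φ) ⊎ (S ⊨ ψ)

Equiv₀ : Structure → Structure → Set
Equiv₀ S₁ S₂ = ∀ (φ : QF) → All (Interpreted S₁) (freeVars φ) → All (Interpreted S₂) (freeVars φ) →
               ((S₁ ⊨ φ → S₂ ⊨ φ) × (S₂ ⊨ φ → S₁ ⊨ φ))

_≡[_]_ : Structure → ℕ → Structure → Set
S₁ ≡[ zero ]  S₂ = Equiv₀ S₁ S₂
S₁ ≡[ suc m ] S₂ =
  (∀ (x : ℕ) →
     (∀ (v₁ : Fin (size S₁)) → ∃ λ (v₂ : Fin (size S₂)) → (S₁ [ v₁ /₁ x ]) ≡[ m ] (S₂ [ v₂ /₁ x ]))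
   × (∀ (v₂ : Fin (size S₂)) → ∃ λ (v₁ : Fin (size S₁)) → (S₁ [ v₁ /₁ x ]) ≡[ m ] (S₂ [ v₂ /₁ x ])))
  × (∀ (X : ℕ) →
     (∀ (U₁ : Subset (size S₁)) → ∃ λ (U₂ : Subset (size S₂)) → (S₁ [ U₁ /₂ X ]) ≡[ m ] (S₂ [ U₂ /₂ X ]))
   × (∀ (U₂ : Subset (size S₂)) → ∃ λ (U₁ : Subset (size S₁)) → (S₁ [ U₁ /₂ X ]) ≡[ m ] (S₂ [ U₂ /₂ X ])))

Rooted : Structure → Set
Rooted S = Is-just (val₁ S root)

OnlyRootFO : Structure → Set
OnlyRootFO S = ∀ x → Is-just (val₁ S x) → x ≡ root

VarsIn : List Var → Structure → Set
VarsIn Ξ S = (∀ x → Is-just (val₁ S x) → fo x ∈ Ξ) × (∀ X → Is-just (val₂ S X) → so X ∈ Ξ)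

isRoot : (S : Structure) → Fin (size S) → Bool
isRoot S v with val₁ S root
... | just r  = ⌊ r ≟ᶠ v ⌋
... | nothing = false

module _ (S₁ S₂ : Structure) where
  private
    n₁ = size S₁
    n₂ = size S₂

  crossEdge : Fin n₁ ⊎ Fin n₂ → Fin n₁ ⊎ Fin n₂ → Bool
  crossEdge (inj₁ a) (inj₁ b) = edge S₁ a b
  crossEdge (inj₂ a) (inj₂ b) = edge S₂ a b
  crossEdge (inj₁ a) (inj₂ b) = isRoot S₁ a ∧ isRoot S₂ b
  crossEdge (inj₂ b) (inj₁ a) = isRoot S₁ a ∧ isRoot S₂ b

  crossEdge-sym : ∀ s t → crossEdge s t ≡ crossEdge t s
  crossEdge-sym (inj₁ a) (inj₁ b) = edge-sym S₁ a b
  crossEdge-sym (inj₂ a) (inj₂ b) = edge-sym S₂ a b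
  crossEdge-sym (inj₁ a) (inj₂ b) = refl
  crossEdge-sym (inj₂ b) (inj₁ a) = refl

  crossEdge-irrefl : ∀ s → crossEdge s s ≡ false
  crossEdge-irrefl (inj₁ a) = edge-irrefl S₁ a
  crossEdge-irrefl (inj₂ a) = edge-irrefl S₂ a

  joinSub : Maybe (Subset n₁) → Maybe (Subset n₂) → Maybe (Subset (n₁ + n₂))
  joinSub nothing   nothing   = nothing
  joinSub (just U₁) nothing   = just λ u → [ U₁ , (λ _ → false) ]′ (splitAt n₁ u)
  joinSub nothing   (just U₂) = just λ u → [ (λ _ → false) , U₂ ]′ (splitAt n₁ u)
  joinSub (just U₁) (just U₂) = just λ u → [ U₁ , U₂ ]′ (splitAt n₁ u)

  sumVal₁ : ℕ → Maybe (Fin (n₁ + n₂))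
  sumVal₁ x = if x ≡ᵇ root
              then map (_↑ˡ n₂) (val₁ S₁ root)
              else (map (_↑ˡ n₂) (val₁ S₁ x) <∣> map (n₁ ↑ʳ_) (val₁ S₂ x))

  _⊕_ : Structure
  _⊕_ = record
    { size        = n₁ + n₂
    ; edge        = λ u v → crossEdge (splitAt n₁ u) (splitAt n₁ v)
    ; edge-sym    = λ u v → crossEdge-sym (splitAt n₁ u) (splitAt n₁ v)
    ; edge-irrefl = λ v → crossEdge-irrefl (splitAt n₁ v)
    ; val₁        = sumVal₁
    ; val₂        = λ X → joinSub (val₂ S₁ X) (val₂ S₂ X)
    }

-- S₀ + c S : c fresh copies of S attached to the root of S₀
_⊕[_]_ : Structure → ℕ → Structure → Structure
S₀ ⊕[ zero ]  S = S₀
S₀ ⊕[ suc c ] S = (S₀ ⊕[ c ] S) ⊕ S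

module Submission where

-- The proof is the Ehrenfeucht–Fraïssé argument for counting copies.
--   1. Labelled structures: graphs with a set of attached vertices (those
--      joined to the base root in a sum), partially placed first-order and
--      totally interpreted second-order variables, with a game equivalence
--      ≈[ k ] that also allows unassigning a variable.  It is an equivalence,
--      invariant under isomorphism, and a congruence for sums (composition
--      theorem); unplaced summands may be permuted.
--   2. Finite index: a structure supported by w names has a code among
--      codeCount k w possible ones, and equal codes imply ≈[ k ].
--   3. Absorption, by induction on k: with at least threshold k w copies of
--      C, one more copy is not noticed in k rounds.  Point moves are answered
--      in the base or in the copy next to it; a set move colours the copies,
--      and by the pigeonhole principle some colour class is large enough to
--      absorb one more member at level k.
--   4. S₀ + p S is an iterated sum of S₀ with p copies of S, and ≈[ m ]
--      implies ≡[ m ]; so q = threshold m |Ξ| works.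

open import Defs
open import Data.Nat using (ℕ; zero; suc; _+_; _*_; _∸_; _≡ᵇ_; _≤_; _<_; _<?_; s≤s; s≤s⁻¹)
open import Data.Nat.Properties
  using (_≟_; ≡ᵇ⇒≡; m≤m+n; m≤n+m; ≤-trans; ≤-reflexive; 1+n≰n; ≮⇒≥; +-monoˡ-≤; +-cancelˡ-<;
         m≤n⇒m≤1+n; suc-injective; m∸n+n≡m)
open import Data.Bool using (Bool; true; false; T; _∧_; if_then_else_)
open import Data.Bool.Properties using () renaming (_≟_ to _≟ᴮ_)
import Data.Vec.Functional as Vector
open import Data.Bool.ListAction using (any)
open import Data.Fin using (Fin; splitAt; _↑ˡ_; _↑ʳ_) renaming (zero to fzero; suc to fsuc)
open import Data.Fin.Properties
  using (splitAt-↑ˡ; splitAt-↑ʳ; splitAt⁻¹-↑ˡ; splitAt⁻¹-↑ʳ; ↑ˡ-injective) renaming (_≟_ to _≟ᶠ_)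
open import Data.Maybe using (Maybe; just; nothing; _<∣>_; maybe′; Is-just) renaming (map to mapᴹ)
open import Data.Maybe.Relation.Unary.Any using () renaming (just to is-just)
open import Data.Maybe.Properties using (just-injective; <∣>-identityʳ) renaming (map-id to mapᴹ-id; ≡-dec to ≡-decᴹ)
open import Data.Sum using (_⊎_; inj₁; inj₂; [_,_]′)
open import Data.Product using (∃; ∃₂; _×_; _,_; proj₁; proj₂)
open import Data.List using (List; []; _∷_; _++_; map; replicate; length; allFin; cartesianProduct; cartesianProductWith)
open import Data.List.Properties using (length-map; length-++; map-++; ∷-injective) renaming (≡-dec to ≡-decᴸ)
open import Data.List.Membership.Propositional using (_∈_; lose)
open import Data.List.Membership.Propositional.Properties
  using (∈-map⁺; ∈-++⁺ˡ; ∈-++⁺ʳ; ∈-allFin; ∈-cartesianProduct⁺; ∈-cartesianProductWith⁺)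
open import Data.List.Relation.Unary.Any using (here; there; satisfied)
open import Data.List.Relation.Unary.Any.Properties using (any⁺; any⁻)
open import Data.List.Relation.Unary.All using (All; []; _∷_; universal)
open import Data.List.Relation.Unary.All.Properties using (replicate⁺; ++⁻ˡ; ++⁻ʳ) renaming (map⁺ to All-map⁺)
open import Data.List.Relation.Binary.Pointwise using (Pointwise; []; _∷_)
open import Data.List.Relation.Binary.Permutation.Propositional using (_↭_; ↭-sym; ↭-trans)
import Data.List.Relation.Binary.Permutation.Propositional as ↭
open import Data.List.Relation.Binary.Permutation.Propositional.Properties
  using (All-resp-↭; ↭-length; shift; shifts) renaming (map⁺ to ↭-map⁺; ++⁺ˡ to ++⁺ˡ-↭)
open import Relation.Binary.Bundles using (Setoid)
import Relation.Binary.Reasoning.Setoid as SetoidReasoning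
open import Data.Vec using (Vec; []; _∷_; lookup; fromList)
open import Data.Empty using (⊥-elim)
open import Data.Unit using (tt)
open import Relation.Nullary using (¬_; Dec; yes; no)
open import Relation.Nullary.Decidable using (⌊_⌋; toWitness; fromWitness; isYes≗does; dec-false)
open import Relation.Binary.Definitions using (DecidableEquality)
open import Relation.Binary.PropositionalEquality

-- A graph carries, besides its edges, a set of
-- "attached" vertices (those joined to the root when the graph is summed
-- onto another one).  First-order variables are placed partially, while
-- second-order variables always denote a set (unassigned ones the empty set).

record Graph : Set where
  constructor graph
  field
    nodes    : ℕ
    edges    : Fin nodes → Fin nodes → Bool
    attached : Fin nodes → Bool

open Graph

record LStr : Set where
  constructor lstr
  field
    graphOf : Graph
    place   : ℕ → Maybe (Fin (nodes graphOf))
    sets    : ℕ → Fin (nodes graphOf) → Bool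

open LStr

order : LStr → ℕ
order L = nodes (graphOf L)

assign : (L : LStr) → Fin (order L) → ℕ → LStr
assign L v x = lstr (graphOf L) (λ y → if y ≡ᵇ x then just v else place L y) (sets L)

unassign : LStr → ℕ → LStr
unassign L x = lstr (graphOf L) (λ y → if y ≡ᵇ x then nothing else place L y) (sets L)

assignSet : (L : LStr) → (Fin (order L) → Bool) → ℕ → LStr
assignSet L U X = lstr (graphOf L) (place L) (λ Y → if Y ≡ᵇ X then U else sets L Y)

edgeBetween : (G : Graph) → Maybe (Fin (nodes G)) → Maybe (Fin (nodes G)) → Maybe Bool
edgeBetween G (just u) (just v) = just (edges G u v)
edgeBetween G (just u) nothing  = nothing
edgeBetween G nothing  _        = nothing

edgeAt : LStr → ℕ → ℕ → Maybe Bool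
edgeAt L x y = edgeBetween (graphOf L) (place L x) (place L y)

attachedAt : LStr → ℕ → Maybe Bool
attachedAt L x = mapᴹ (attached (graphOf L)) (place L x)

memberAt : LStr → ℕ → ℕ → Maybe Bool
memberAt L x X = mapᴹ (sets L X) (place L x)

Agree₀ : LStr → LStr → Set
Agree₀ C D = (∀ x y → edgeAt C x y ≡ edgeAt D x y)
           × (∀ x → attachedAt C x ≡ attachedAt D x)
           × (∀ x X → memberAt C x X ≡ memberAt D x X)

BackForth : {A B : Set} → (A → B → Set) → Set
BackForth {A} {B} R = (∀ a → ∃ λ b → R a b) × (∀ b → ∃ λ a → R a b)

BackForth-sym : {A B : Set} {R : A → B → Set} {R' : B → A → Set} →
                (∀ {a b} → R a b → R' b a) → BackForth R → BackForth R'
BackForth-sym s (forth , back) =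
  (λ b → let (a , r) = back b in a , s r) , (λ a → let (b , r) = forth a in b , s r)

BackForth-trans : {A B C : Set} {R : A → B → Set} {R' : B → C → Set} {R'' : A → C → Set} →
                  (∀ {a b c} → R a b → R' b c → R'' a c) →
                  BackForth R → BackForth R' → BackForth R''
BackForth-trans t (forth , back) (forth' , back') =
  (λ a → let (b , r) = forth a ; (c , r') = forth' b in c , t r r')
  , (λ c → let (b , r') = back' c ; (a , r) = back b in a , t r r')

-- Besides the moves of
-- ≡[_], it also lets the spoiler unassign a first-order variable; this is
-- what makes it a congruence for sums, where a variable placed in one summand
-- is unassigned in the other one.
infix 4 _≈[_]_
_≈[_]_ : LStr → ℕ → LStr → Set
C ≈[ zero ]  D = Agree₀ C D
C ≈[ suc k ] D =
  (∀ x → BackForth (λ v w → assign C v x ≈[ k ] assign D w x) × (unassign C x ≈[ k ] unassign D x))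
  × (∀ X → BackForth (λ U U' → assignSet C U X ≈[ k ] assignSet D U' X))

≈-sym : ∀ k {C D} → C ≈[ k ] D → D ≈[ k ] C
≈-sym zero (e , a , m) = (λ x y → sym (e x y)) , (λ x → sym (a x)) , (λ x X → sym (m x X))
≈-sym (suc k) (F , S) =
  (λ x → BackForth-sym (≈-sym k) (proj₁ (F x)) , ≈-sym k (proj₂ (F x)))
  , (λ X → BackForth-sym (≈-sym k) (S X))

≈-trans : ∀ k {A B C} → A ≈[ k ] B → B ≈[ k ] C → A ≈[ k ] C
≈-trans zero (e , a , m) (e' , a' , m') =
  (λ x y → trans (e x y) (e' x y)) , (λ x → trans (a x) (a' x)) , (λ x X → trans (m x X) (m' x X))
≈-trans (suc k) (F , S) (F' , S') =
  (λ x → BackForth-trans (≈-trans k) (proj₁ (F x)) (proj₁ (F' x)) , ≈-trans k (proj₂ (F x)) (proj₂ (F' x)))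
  , (λ X → BackForth-trans (≈-trans k) (S X) (S' X))

record Iso (A B : LStr) : Set where
  field
    to            : Fin (order A) → Fin (order B)
    from          : Fin (order B) → Fin (order A)
    to-from       : ∀ w → to (from w) ≡ w
    from-to       : ∀ v → from (to v) ≡ v
    edges-pres    : ∀ u v → edges (graphOf B) (to u) (to v) ≡ edges (graphOf A) u v
    attached-pres : ∀ u → attached (graphOf B) (to u) ≡ attached (graphOf A) u
    place-pres    : ∀ x → place B x ≡ mapᴹ to (place A x)
    sets-pres     : ∀ X u → sets B X (to u) ≡ sets A X u

open Iso

pointwiseIso : ∀ {n} {e e' : Fin n → Fin n → Bool} {a a' : Fin n → Bool}
               {l l' : ℕ → Maybe (Fin n)} {s s' : ℕ → Fin n → Bool} →
               (∀ u v → e' u v ≡ e u v) → (∀ u → a' u ≡ a u) →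
               (∀ x → l' x ≡ l x) → (∀ X u → s' X u ≡ s X u) →
               Iso (lstr (graph n e a) l s) (lstr (graph n e' a') l' s')
pointwiseIso {l = l} ee ea el es = record
  { to = λ v → v ; from = λ v → v ; to-from = λ _ → refl ; from-to = λ _ → refl
  ; edges-pres = ee ; attached-pres = ea ; place-pres = λ x → trans (el x) (sym (mapᴹ-id (l x)))
  ; sets-pres = es }

relabel : ∀ {L} {l' : ℕ → Maybe (Fin (order L))} {s' : ℕ → Fin (order L) → Bool} →
          (∀ x → l' x ≡ place L x) → (∀ X u → s' X u ≡ sets L X u) → Iso L (lstr (graphOf L) l' s')
relabel = pointwiseIso (λ _ _ → refl) (λ _ → refl)

isoAssign : ∀ {A B} (I : Iso A B) v w x → to I v ≡ w → Iso (assign A v x) (assign B w x)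
isoAssign {A} {B} I v w x eq = record
  { to = to I ; from = from I ; to-from = to-from I ; from-to = from-to I ; edges-pres = edges-pres I
  ; attached-pres = attached-pres I ; sets-pres = sets-pres I ; place-pres = placed }
  where
  placed : ∀ y → (if y ≡ᵇ x then just w else place B y) ≡ mapᴹ (to I) (if y ≡ᵇ x then just v else place A y)
  placed y with y ≡ᵇ x
  ... | true  = cong just (sym eq)
  ... | false = place-pres I y

isoUnassign : ∀ {A B} (I : Iso A B) x → Iso (unassign A x) (unassign B x)
isoUnassign {A} {B} I x = record
  { to = to I ; from = from I ; to-from = to-from I ; from-to = from-to I ; edges-pres = edges-pres I
  ; attached-pres = attached-pres I ; sets-pres = sets-pres I ; place-pres = placed }
  where
  placed : ∀ y → (if y ≡ᵇ x then nothing else place B y) ≡ mapᴹ (to I) (if y ≡ᵇ x then nothing else place A y)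
  placed y with y ≡ᵇ x
  ... | true  = refl
  ... | false = place-pres I y

isoAssignSet : ∀ {A B} (I : Iso A B) U U' X → (∀ u → U' (to I u) ≡ U u) →
               Iso (assignSet A U X) (assignSet B U' X)
isoAssignSet {A} {B} I U U' X eq = record
  { to = to I ; from = from I ; to-from = to-from I ; from-to = from-to I ; edges-pres = edges-pres I
  ; attached-pres = attached-pres I ; place-pres = place-pres I ; sets-pres = coloured }
  where
  coloured : ∀ Y u → (if Y ≡ᵇ X then U' else sets B Y) (to I u) ≡ (if Y ≡ᵇ X then U else sets A Y) u
  coloured Y u with Y ≡ᵇ X
  ... | true  = eq u
  ... | false = sets-pres I Y u

iso⇒≈ : ∀ k {A B} → Iso A B → A ≈[ k ] B
iso⇒≈ zero {A} {B} I = sameEdges , sameAttached , sameMember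
  where
  sameEdges : ∀ x y → edgeAt A x y ≡ edgeAt B x y
  sameEdges x y rewrite place-pres I x | place-pres I y with place A x | place A y
  ... | just u  | just v  = cong just (sym (edges-pres I u v))
  ... | just u  | nothing = refl
  ... | nothing | _       = refl
  sameAttached : ∀ x → attachedAt A x ≡ attachedAt B x
  sameAttached x rewrite place-pres I x with place A x
  ... | just u  = cong just (sym (attached-pres I u))
  ... | nothing = refl
  sameMember : ∀ x X → memberAt A x X ≡ memberAt B x X
  sameMember x X rewrite place-pres I x with place A x
  ... | just u  = cong just (sym (sets-pres I X u))
  ... | nothing = refl
iso⇒≈ (suc k) I =
  (λ x → ( (λ v → to I v , iso⇒≈ k (isoAssign I v (to I v) x refl))
         , (λ w → from I w , iso⇒≈ k (isoAssign I (from I w) w x (to-from I w))))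
         , iso⇒≈ k (isoUnassign I x))
  , (λ X → (λ U → (λ w → U (from I w)) , iso⇒≈ k (isoAssignSet I U _ X (λ u → cong U (from-to I u))))
         , (λ U' → (λ v → U' (to I v)) , iso⇒≈ k (isoAssignSet I _ U' X (λ u → refl))))

isoRefl : ∀ A → Iso A A
isoRefl A = relabel {A} (λ _ → refl) (λ _ _ → refl)

≈-refl : ∀ k A → A ≈[ k ] A
≈-refl k A = iso⇒≈ k (isoRefl A)

≈-setoid : ℕ → Setoid _ _
≈-setoid k = record
  { Carrier = LStr ; _≈_ = _≈[ k ]_
  ; isEquivalence = record { refl = λ {A} → ≈-refl k A ; sym = ≈-sym k ; trans = ≈-trans k } }

module ≈-Reasoning (k : ℕ) = SetoidReasoning (≈-setoid k)

≈-via-iso : ∀ k {P P' Q Q'} → Iso P Q → Q ≈[ k ] Q' → Iso P' Q' → P ≈[ k ] P'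
≈-via-iso k I q I' = ≈-trans k (iso⇒≈ k I) (≈-trans k q (≈-sym k (iso⇒≈ k I')))

forth₁ : ∀ {k C D} → C ≈[ suc k ] D → ∀ x v → ∃ λ w → assign C v x ≈[ k ] assign D w x
forth₁ (F , _) x = proj₁ (proj₁ (F x))

back₁ : ∀ {k C D} → C ≈[ suc k ] D → ∀ x w → ∃ λ v → assign C v x ≈[ k ] assign D w x
back₁ (F , _) x = proj₂ (proj₁ (F x))

unassign≈ : ∀ {k C D} → C ≈[ suc k ] D → ∀ x → unassign C x ≈[ k ] unassign D x
unassign≈ (F , _) x = proj₂ (F x)

forth₂ : ∀ {k C D} → C ≈[ suc k ] D → ∀ X U → ∃ λ U' → assignSet C U X ≈[ k ] assignSet D U' X
forth₂ (_ , S) X = proj₁ (S X)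

back₂ : ∀ {k C D} → C ≈[ suc k ] D → ∀ X U' → ∃ λ U → assignSet C U X ≈[ k ] assignSet D U' X
back₂ (_ , S) X = proj₂ (S X)

data Side (m n : ℕ) : Fin (m + n) → Set where
  left  : (a : Fin m) → Side m n (a ↑ˡ n)
  right : (b : Fin n) → Side m n (m ↑ʳ b)

side : ∀ m n u → Side m n u
side m n u with splitAt m u in eq
... | inj₁ a rewrite sym (splitAt⁻¹-↑ˡ eq) = left a
... | inj₂ b rewrite sym (splitAt⁻¹-↑ʳ eq) = right b

joinSet : ∀ {m n} {B : Set} → (Fin m → B) → (Fin n → B) → Fin (m + n) → B
joinSet {m} U₁ U₂ u = [ U₁ , U₂ ]′ (splitAt m u)

joinSet-left : ∀ {m n} {B : Set} (U₁ : Fin m → B) (U₂ : Fin n → B) a → joinSet U₁ U₂ (a ↑ˡ n) ≡ U₁ a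
joinSet-left {m} {n} U₁ U₂ a = cong [ U₁ , U₂ ]′ (splitAt-↑ˡ m a n)

joinSet-right : ∀ {m n} {B : Set} (U₁ : Fin m → B) (U₂ : Fin n → B) b → joinSet U₁ U₂ (m ↑ʳ b) ≡ U₂ b
joinSet-right {m} {n} U₁ U₂ b = cong [ U₁ , U₂ ]′ (splitAt-↑ʳ m n b)

module _ (A B : Graph) where
  crossEdges : Fin (nodes A) ⊎ Fin (nodes B) → Fin (nodes A) ⊎ Fin (nodes B) → Bool
  crossEdges (inj₁ a) (inj₁ a') = edges A a a'
  crossEdges (inj₂ b) (inj₂ b') = edges B b b'
  crossEdges (inj₁ a) (inj₂ b)  = attached A a ∧ attached B b
  crossEdges (inj₂ b) (inj₁ a)  = attached A a ∧ attached B b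

graphSum : Graph → Graph → Graph
graphSum G H = graph (nodes G + nodes H)
  (λ u v → crossEdges G H (splitAt (nodes G) u) (splitAt (nodes G) v))
  (joinSet (attached G) (λ _ → false))

infixl 6 _⊞_
_⊞_ : LStr → LStr → LStr
A ⊞ B = lstr (graphSum (graphOf A) (graphOf B))
  (λ x → mapᴹ (_↑ˡ order B) (place A x) <∣> mapᴹ (order A ↑ʳ_) (place B x))
  (λ X → joinSet (sets A X) (sets B X))

sumAssignˡ : ∀ A B a x → Iso (assign (A ⊞ B) (a ↑ˡ order B) x) (assign A a x ⊞ unassign B x)
sumAssignˡ A B a x = relabel placed (λ _ _ → refl)
  where
  placed : ∀ y → (mapᴹ (_↑ˡ order B) (if y ≡ᵇ x then just a else place A y)
                   <∣> mapᴹ (order A ↑ʳ_) (if y ≡ᵇ x then nothing else place B y))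
                 ≡ (if y ≡ᵇ x then just (a ↑ˡ order B) else place (A ⊞ B) y)
  placed y with y ≡ᵇ x
  ... | true  = refl
  ... | false = refl

sumAssignʳ : ∀ A B b x → Iso (assign (A ⊞ B) (order A ↑ʳ b) x) (unassign A x ⊞ assign B b x)
sumAssignʳ A B b x = relabel placed (λ _ _ → refl)
  where
  placed : ∀ y → (mapᴹ (_↑ˡ order B) (if y ≡ᵇ x then nothing else place A y)
                   <∣> mapᴹ (order A ↑ʳ_) (if y ≡ᵇ x then just b else place B y))
                 ≡ (if y ≡ᵇ x then just (order A ↑ʳ b) else place (A ⊞ B) y)
  placed y with y ≡ᵇ x
  ... | true  = refl
  ... | false = refl

sumUnassign : ∀ A B x → Iso (unassign (A ⊞ B) x) (unassign A x ⊞ unassign B x)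
sumUnassign A B x = relabel placed (λ _ _ → refl)
  where
  placed : ∀ y → (mapᴹ (_↑ˡ order B) (if y ≡ᵇ x then nothing else place A y)
                   <∣> mapᴹ (order A ↑ʳ_) (if y ≡ᵇ x then nothing else place B y))
                 ≡ (if y ≡ᵇ x then nothing else place (A ⊞ B) y)
  placed y with y ≡ᵇ x
  ... | true  = refl
  ... | false = refl

sumAssignSet : ∀ A B U₁ U₂ X → Iso (assignSet (A ⊞ B) (joinSet U₁ U₂) X) (assignSet A U₁ X ⊞ assignSet B U₂ X)
sumAssignSet A B U₁ U₂ X = relabel (λ _ → refl) coloured
  where
  coloured : ∀ Y u → joinSet (if Y ≡ᵇ X then U₁ else sets A Y) (if Y ≡ᵇ X then U₂ else sets B Y) u
                     ≡ (if Y ≡ᵇ X then joinSet U₁ U₂ else joinSet (sets A Y) (sets B Y)) u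
  coloured Y u with Y ≡ᵇ X
  ... | true  = refl
  ... | false = refl

sumAssignSetRestrict : ∀ L M X (U : Fin (order L + order M) → Bool) →
  Iso (assignSet (L ⊞ M) U X) (assignSet L (λ a → U (a ↑ˡ order M)) X ⊞ assignSet M (λ b → U (order L ↑ʳ b)) X)
sumAssignSetRestrict L M X U = relabel (λ _ → refl) coloured
  where
  coloured : ∀ Y u → joinSet (if Y ≡ᵇ X then (λ a → U (a ↑ˡ order M)) else sets L Y)
                             (if Y ≡ᵇ X then (λ b → U (order L ↑ʳ b)) else sets M Y) u
                     ≡ (if Y ≡ᵇ X then U else joinSet (sets L Y) (sets M Y)) u
  coloured Y u with Y ≡ᵇ X
  ... | false = refl
  ... | true with side (order L) (order M) u
  ...   | left a  = joinSet-left _ (λ b → U (order L ↑ʳ b)) a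
  ...   | right b = joinSet-right (λ a → U (a ↑ˡ order M)) _ b

-- The level-0 data of a sum is a function of the level-0 data of its summands
-- (the arguments are the attachment data of x and y in A and B, then the edge data).
sumEdgeData : (ax bx ay by eA eB : Maybe Bool) → Maybe Bool
sumEdgeData (just _) _        (just _) _        eA _  = eA
sumEdgeData (just α) _        nothing  (just β) _  _  = just (α ∧ β)
sumEdgeData (just _) _        nothing  nothing  _  _  = nothing
sumEdgeData nothing  (just β) (just α) _        _  _  = just (α ∧ β)
sumEdgeData nothing  (just _) nothing  (just _) _  eB = eB
sumEdgeData nothing  (just _) nothing  nothing  _  _  = nothing
sumEdgeData nothing  nothing  _        _        _  _  = nothing

sumAttachedData : (ax bx : Maybe Bool) → Maybe Bool
sumAttachedData (just α) _        = just α
sumAttachedData nothing  (just _) = just false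
sumAttachedData nothing  nothing  = nothing

sumMemberData : (ax bx mA mB : Maybe Bool) → Maybe Bool
sumMemberData (just _) _        mA _  = mA
sumMemberData nothing  (just _) _  mB = mB
sumMemberData nothing  nothing  _  _  = nothing

sumEdgeAt : ∀ A B x y → edgeAt (A ⊞ B) x y ≡
  sumEdgeData (attachedAt A x) (attachedAt B x) (attachedAt A y) (attachedAt B y) (edgeAt A x y) (edgeAt B x y)
sumEdgeAt A B x y with place A x | place B x | place A y | place B y
... | just a  | _      | just a' | _
  rewrite splitAt-↑ˡ (order A) a (order B) | splitAt-↑ˡ (order A) a' (order B) = refl
... | just a  | _      | nothing | just b'
  rewrite splitAt-↑ˡ (order A) a (order B) | splitAt-↑ʳ (order A) (order B) b' = refl
... | just a  | _      | nothing | nothing = refl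
... | nothing | just b | just a' | _
  rewrite splitAt-↑ʳ (order A) (order B) b | splitAt-↑ˡ (order A) a' (order B) = refl
... | nothing | just b | nothing | just b'
  rewrite splitAt-↑ʳ (order A) (order B) b | splitAt-↑ʳ (order A) (order B) b' = refl
... | nothing | just b | nothing | nothing = refl
... | nothing | nothing | _      | _       = refl

sumAttachedAt : ∀ A B x → attachedAt (A ⊞ B) x ≡ sumAttachedData (attachedAt A x) (attachedAt B x)
sumAttachedAt A B x with place A x | place B x
... | just a  | _      rewrite splitAt-↑ˡ (order A) a (order B) = refl
... | nothing | just b rewrite splitAt-↑ʳ (order A) (order B) b = refl
... | nothing | nothing = refl

sumMemberAt : ∀ A B x X → memberAt (A ⊞ B) x X ≡
  sumMemberData (attachedAt A x) (attachedAt B x) (memberAt A x X) (memberAt B x X)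
sumMemberAt A B x X with place A x | place B x
... | just a  | _      rewrite splitAt-↑ˡ (order A) a (order B) = refl
... | nothing | just b rewrite splitAt-↑ʳ (order A) (order B) b = refl
... | nothing | nothing = refl

cong⊞ : ∀ k {A A' B B'} → A ≈[ k ] A' → B ≈[ k ] B' → A ⊞ B ≈[ k ] A' ⊞ B'
cong⊞ zero {A} {A'} {B} {B'} (eA , aA , mA) (eB , aB , mB) = sameEdges , sameAttached , sameMember
  where
  sameEdges : ∀ x y → edgeAt (A ⊞ B) x y ≡ edgeAt (A' ⊞ B') x y
  sameEdges x y rewrite sumEdgeAt A B x y | sumEdgeAt A' B' x y
    | aA x | aB x | aA y | aB y | eA x y | eB x y = refl
  sameAttached : ∀ x → attachedAt (A ⊞ B) x ≡ attachedAt (A' ⊞ B') x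
  sameAttached x rewrite sumAttachedAt A B x | sumAttachedAt A' B' x | aA x | aB x = refl
  sameMember : ∀ x X → memberAt (A ⊞ B) x X ≡ memberAt (A' ⊞ B') x X
  sameMember x X rewrite sumMemberAt A B x X | sumMemberAt A' B' x X | aA x | aB x | mA x X | mB x X = refl
cong⊞ (suc k) {A} {A'} {B} {B'} pA pB =
  (λ x → (forthV x , backV x)
         , ≈-via-iso k (sumUnassign A B x) (cong⊞ k (unassign≈ pA x) (unassign≈ pB x)) (sumUnassign A' B' x))
  , (λ X → forthS X , backS X)
  where
  forthV : ∀ x v → ∃ λ w → assign (A ⊞ B) v x ≈[ k ] assign (A' ⊞ B') w x
  forthV x v with side (order A) (order B) v
  ... | left a  = let (a' , p) = forth₁ pA x a in
    a' ↑ˡ order B' , ≈-via-iso k (sumAssignˡ A B a x) (cong⊞ k p (unassign≈ pB x)) (sumAssignˡ A' B' a' x)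
  ... | right b = let (b' , p) = forth₁ pB x b in
    order A' ↑ʳ b' , ≈-via-iso k (sumAssignʳ A B b x) (cong⊞ k (unassign≈ pA x) p) (sumAssignʳ A' B' b' x)
  backV : ∀ x w → ∃ λ v → assign (A ⊞ B) v x ≈[ k ] assign (A' ⊞ B') w x
  backV x w with side (order A') (order B') w
  ... | left a'  = let (a , p) = back₁ pA x a' in
    a ↑ˡ order B , ≈-via-iso k (sumAssignˡ A B a x) (cong⊞ k p (unassign≈ pB x)) (sumAssignˡ A' B' a' x)
  ... | right b' = let (b , p) = back₁ pB x b' in
    order A ↑ʳ b , ≈-via-iso k (sumAssignʳ A B b x) (cong⊞ k (unassign≈ pA x) p) (sumAssignʳ A' B' b' x)
  forthS : ∀ X U → ∃ λ U' → assignSet (A ⊞ B) U X ≈[ k ] assignSet (A' ⊞ B') U' X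
  forthS X U =
    let (U₁ , p₁) = forth₂ pA X (λ a → U (a ↑ˡ order B))
        (U₂ , p₂) = forth₂ pB X (λ b → U (order A ↑ʳ b))
    in joinSet U₁ U₂ , ≈-via-iso k (sumAssignSetRestrict A B X U) (cong⊞ k p₁ p₂) (sumAssignSet A' B' U₁ U₂ X)
  backS : ∀ X U' → ∃ λ U → assignSet (A ⊞ B) U X ≈[ k ] assignSet (A' ⊞ B') U' X
  backS X U' =
    let (U₁ , p₁) = back₂ pA X (λ a → U' (a ↑ˡ order B'))
        (U₂ , p₂) = back₂ pB X (λ b → U' (order A' ↑ʳ b))
    in joinSet U₁ U₂ , ≈-via-iso k (sumAssignSet A B U₁ U₂ X) (cong⊞ k p₁ p₂) (sumAssignSetRestrict A' B' X U')

Unplaced : LStr → Set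
Unplaced C = ∀ x → place C x ≡ nothing

data Third (a b c : ℕ) : Fin (a + b + c) → Set where
  first  : (x : Fin a) → Third a b c ((x ↑ˡ b) ↑ˡ c)
  second : (y : Fin b) → Third a b c ((a ↑ʳ y) ↑ˡ c)
  third  : (z : Fin c) → Third a b c ((a + b) ↑ʳ z)

thirds : ∀ a b c u → Third a b c u
thirds a b c u with side (a + b) c u
... | right z = third z
... | left w with side a b w
...   | left x  = first x
...   | right y = second y

swapParts : ∀ a b c → Fin (a + b + c) → Fin (a + c + b)
swapParts a b c u = joinSet (joinSet (λ x → (x ↑ˡ c) ↑ˡ b) (λ y → (a + c) ↑ʳ y)) (λ z → (a ↑ʳ z) ↑ˡ b) u

module _ (a b c : ℕ) where
  swapParts-first : ∀ x → swapParts a b c ((x ↑ˡ b) ↑ˡ c) ≡ (x ↑ˡ c) ↑ˡ b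
  swapParts-first x rewrite splitAt-↑ˡ (a + b) (x ↑ˡ b) c | splitAt-↑ˡ a x b = refl

  swapParts-second : ∀ y → swapParts a b c ((a ↑ʳ y) ↑ˡ c) ≡ (a + c) ↑ʳ y
  swapParts-second y rewrite splitAt-↑ˡ (a + b) (a ↑ʳ y) c | splitAt-↑ʳ a b y = refl

  swapParts-third : ∀ z → swapParts a b c ((a + b) ↑ʳ z) ≡ (a ↑ʳ z) ↑ˡ b
  swapParts-third z rewrite splitAt-↑ʳ (a + b) c z = refl

swapParts-involutive : ∀ a b c u → swapParts a c b (swapParts a b c u) ≡ u
swapParts-involutive a b c u with thirds a b c u
... | first x  rewrite swapParts-first a b c x  = swapParts-first a c b x
... | second y rewrite swapParts-second a b c y = swapParts-third a c b y
... | third z  rewrite swapParts-third a b c z  = swapParts-second a c b z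

-- The splitting equations for (X ⊞ C) ⊞ D and (X ⊞ D) ⊞ C, where X, C, D have
-- a, b, c vertices: l and r split the outer sums, b and c the inner ones.
module Splittings (a b c : ℕ) where
  l1 : ∀ x → splitAt (a + b) ((x ↑ˡ b) ↑ˡ c) ≡ inj₁ (x ↑ˡ b)
  l1 x = splitAt-↑ˡ (a + b) (x ↑ˡ b) c
  l2 : ∀ y → splitAt (a + b) ((a ↑ʳ y) ↑ˡ c) ≡ inj₁ (a ↑ʳ y)
  l2 y = splitAt-↑ˡ (a + b) (a ↑ʳ y) c
  l3 : ∀ z → splitAt (a + b) ((a + b) ↑ʳ z) ≡ inj₂ z
  l3 z = splitAt-↑ʳ (a + b) c z
  r1 : ∀ x → splitAt (a + c) ((x ↑ˡ c) ↑ˡ b) ≡ inj₁ (x ↑ˡ c)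
  r1 x = splitAt-↑ˡ (a + c) (x ↑ˡ c) b
  r2 : ∀ y → splitAt (a + c) ((a + c) ↑ʳ y) ≡ inj₂ y
  r2 y = splitAt-↑ʳ (a + c) b y
  r3 : ∀ z → splitAt (a + c) ((a ↑ʳ z) ↑ˡ b) ≡ inj₁ (a ↑ʳ z)
  r3 z = splitAt-↑ˡ (a + c) (a ↑ʳ z) b
  b1 : ∀ x → splitAt a (x ↑ˡ b) ≡ inj₁ x
  b1 x = splitAt-↑ˡ a x b
  b2 : ∀ y → splitAt a {b} (a ↑ʳ y) ≡ inj₂ y
  b2 y = splitAt-↑ʳ a b y
  c1 : ∀ x → splitAt a (x ↑ˡ c) ≡ inj₁ x
  c1 x = splitAt-↑ˡ a x c
  c3 : ∀ z → splitAt a {c} (a ↑ʳ z) ≡ inj₂ z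
  c3 z = splitAt-↑ʳ a c z

-- Two summands may be exchanged as long as one of them places no variable
-- (the other one may, since a variable is read from the first summand placing it).
swapIso : ∀ X C D → Unplaced C → Iso ((X ⊞ C) ⊞ D) ((X ⊞ D) ⊞ C)
swapIso X C D unplaced = record
  { to = σ ; from = swapParts a c b
  ; to-from = swapParts-involutive a c b ; from-to = swapParts-involutive a b c
  ; edges-pres = sameEdges ; attached-pres = sameAttached ; place-pres = samePlace ; sets-pres = sameSets }
  where
  a = order X
  b = order C
  c = order D
  σ = swapParts a b c
  L = (X ⊞ C) ⊞ D
  R = (X ⊞ D) ⊞ C
  open Splittings a b c
  f1 = swapParts-first a b c
  f2 = swapParts-second a b c
  f3 = swapParts-third a b c
  sameEdges : ∀ u v → edges (graphOf R) (σ u) (σ v) ≡ edges (graphOf L) u v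
  sameEdges u v with thirds a b c u | thirds a b c v
  ... | first x  | first x'  rewrite f1 x | f1 x' | l1 x | l1 x' | r1 x | r1 x' | b1 x | b1 x' | c1 x | c1 x' = refl
  ... | first x  | second y' rewrite f1 x | f2 y' | l1 x | l2 y' | r1 x | r2 y' | b1 x | b2 y' | c1 x = refl
  ... | first x  | third z'  rewrite f1 x | f3 z' | l1 x | l3 z' | r1 x | r3 z' | b1 x | c1 x | c3 z' = refl
  ... | second y | first x'  rewrite f2 y | f1 x' | l2 y | l1 x' | r2 y | r1 x' | b2 y | b1 x' | c1 x' = refl
  ... | second y | second y' rewrite f2 y | f2 y' | l2 y | l2 y' | r2 y | r2 y' | b2 y | b2 y' = refl
  ... | second y | third z'  rewrite f2 y | f3 z' | l2 y | l3 z' | r2 y | r3 z' | b2 y | c3 z' = refl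
  ... | third z  | first x'  rewrite f3 z | f1 x' | l3 z | l1 x' | r3 z | r1 x' | b1 x' | c1 x' | c3 z = refl
  ... | third z  | second y' rewrite f3 z | f2 y' | l3 z | l2 y' | r3 z | r2 y' | b2 y' | c3 z = refl
  ... | third z  | third z'  rewrite f3 z | f3 z' | l3 z | l3 z' | r3 z | r3 z' | c3 z | c3 z' = refl
  sameAttached : ∀ u → attached (graphOf R) (σ u) ≡ attached (graphOf L) u
  sameAttached u with thirds a b c u
  ... | first x  rewrite f1 x | l1 x | r1 x | b1 x | c1 x = refl
  ... | second y rewrite f2 y | l2 y | r2 y | b2 y = refl
  ... | third z  rewrite f3 z | l3 z | r3 z | c3 z = refl
  sameSets : ∀ Y u → sets R Y (σ u) ≡ sets L Y u
  sameSets Y u with thirds a b c u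
  ... | first x  rewrite f1 x | l1 x | r1 x | b1 x | c1 x = refl
  ... | second y rewrite f2 y | l2 y | r2 y | b2 y = refl
  ... | third z  rewrite f3 z | l3 z | r3 z | c3 z = refl
  samePlace : ∀ y → place R y ≡ mapᴹ σ (place L y)
  samePlace y rewrite unplaced y with place X y | place D y
  ... | just p  | _       rewrite f1 p = refl
  ... | nothing | just d  rewrite f3 d = refl
  ... | nothing | nothing = refl

infixl 6 _⊞*_
_⊞*_ : LStr → List LStr → LStr
B ⊞* []       = B
B ⊞* (C ∷ Cs) = (B ⊞* Cs) ⊞ C

⊞*-cong : ∀ k {B B' Cs Ds} → B ≈[ k ] B' → Pointwise _≈[ k ]_ Cs Ds → B ⊞* Cs ≈[ k ] B' ⊞* Ds
⊞*-cong k p []       = p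
⊞*-cong k p (q ∷ qs) = cong⊞ k (⊞*-cong k p qs) q

⊞*-perm : ∀ k B {Cs Ds} → All Unplaced Cs → Cs ↭ Ds → B ⊞* Cs ≈[ k ] B ⊞* Ds
⊞*-perm k B _ ↭.refl = ≈-refl k _
⊞*-perm k B (_ ∷ unplaced) (↭.prep C p) = cong⊞ k (⊞*-perm k B unplaced p) (≈-refl k C)
⊞*-perm k B {C ∷ D ∷ Cs} (_ ∷ unplacedD ∷ unplaced) (↭.swap .C .D p) =
  ≈-trans k (iso⇒≈ k (swapIso (B ⊞* Cs) D C unplacedD))
            (cong⊞ k (cong⊞ k (⊞*-perm k B unplaced p) (≈-refl k C)) (≈-refl k D))
⊞*-perm k B unplaced (↭.trans p q) = ≈-trans k (⊞*-perm k B unplaced p) (⊞*-perm k B (All-resp-↭ p unplaced) q)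

pullForward : ∀ k B A {Cs} → All Unplaced Cs → (B ⊞* Cs) ⊞ A ≈[ k ] (B ⊞ A) ⊞* Cs
pullForward k B A [] = ≈-refl k _
pullForward k B A {C ∷ Cs} (unplacedC ∷ unplaced) =
  ≈-trans k (iso⇒≈ k (swapIso (B ⊞* Cs) C A unplacedC)) (cong⊞ k (pullForward k B A unplaced) (≈-refl k C))

unassign-unplaced : ∀ {C} x → Unplaced C → Iso C (unassign C x)
unassign-unplaced {C} x unplaced = relabel placed (λ _ _ → refl)
  where
  placed : ∀ y → (if y ≡ᵇ x then nothing else place C y) ≡ place C y
  placed y with y ≡ᵇ x
  ... | true  = sym (unplaced y)
  ... | false = refl

unassign-⊞* : ∀ k B {Cs} x → All Unplaced Cs → unassign (B ⊞* Cs) x ≈[ k ] unassign B x ⊞* Cs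
unassign-⊞* k B x [] = ≈-refl k _
unassign-⊞* k B {C ∷ Cs} x (unplacedC ∷ unplaced) =
  ≈-trans k (iso⇒≈ k (sumUnassign (B ⊞* Cs) C x))
    (cong⊞ k (unassign-⊞* k B x unplaced) (≈-sym k (iso⇒≈ k (unassign-unplaced x unplacedC))))

assign-left : ∀ k {Z W} C v x → Unplaced C → assign Z v x ≈[ k ] W →
              assign (Z ⊞ C) (v ↑ˡ order C) x ≈[ k ] W ⊞ C
assign-left k {Z} C v x unplaced p =
  ≈-trans k (iso⇒≈ k (sumAssignˡ Z C v x)) (cong⊞ k p (≈-sym k (iso⇒≈ k (unassign-unplaced x unplaced))))

inBase : ∀ B Cs → Fin (order B) → Fin (order (B ⊞* Cs))
inBase B []       b = b
inBase B (C ∷ Cs) b = inBase B Cs b ↑ˡ order C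

assign-inBase : ∀ k B {Cs} b x → All Unplaced Cs → assign (B ⊞* Cs) (inBase B Cs b) x ≈[ k ] assign B b x ⊞* Cs
assign-inBase k B b x [] = ≈-refl k _
assign-inBase k B {C ∷ Cs} b x (unplacedC ∷ unplaced) =
  assign-left k C (inBase B Cs b) x unplacedC (assign-inBase k B b x unplaced)

assign-inCopy : ∀ k B C {Cs} c x → All Unplaced Cs →
                assign (B ⊞* (C ∷ Cs)) (order (B ⊞* Cs) ↑ʳ c) x ≈[ k ] (unassign B x ⊞ assign C c x) ⊞* Cs
assign-inCopy k B C {Cs} c x unplaced =
  ≈-trans k (iso⇒≈ k (sumAssignʳ (B ⊞* Cs) C c x))
    (≈-trans k (cong⊞ k (unassign-⊞* k B x unplaced) (≈-refl k (assign C c x)))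
               (pullForward k (unassign B x) (assign C c x) unplaced))

locate : ∀ k B C → Unplaced C → ∀ n v x →
  (∃ λ b → assign (B ⊞* replicate (suc n) C) v x ≈[ k ] assign B b x ⊞* replicate (suc n) C)
  ⊎ (∃ λ c → assign (B ⊞* replicate (suc n) C) v x ≈[ k ] (unassign B x ⊞ assign C c x) ⊞* replicate n C)
locate k B C unplaced zero v x with side (order B) (order C) v
... | left b  = inj₁ (b , assign-left k C b x unplaced (≈-refl k _))
... | right c = inj₂ (c , assign-inCopy k B C c x [])
locate k B C unplaced (suc n) v x with side (order (B ⊞* replicate (suc n) C)) (order C) v
... | right c = inj₂ (c , assign-inCopy k B C c x (replicate⁺ (suc n) unplaced))
... | left v' with locate k B C unplaced n v' x
...   | inj₁ (b , p) = inj₁ (b , assign-left k C v' x unplaced p)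
...   | inj₂ (c , p) = inj₂ (c , assign-left k C v' x unplaced p)

withSets : (C : LStr) → ℕ → List (Fin (order C) → Bool) → List LStr
withSets C X Vs = map (λ V → assignSet C V X) Vs

assignSet-split : ∀ k B C n X U → ∃₂ λ UB Vs → length Vs ≡ n ×
                  assignSet (B ⊞* replicate n C) U X ≈[ k ] assignSet B UB X ⊞* withSets C X Vs
assignSet-split k B C zero X U = U , [] , refl , ≈-refl k _
assignSet-split k B C (suc n) X U =
  let (UB , Vs , length≡ , p) = assignSet-split k B C n X (λ a → U (a ↑ˡ order C))
  in UB , (λ b → U (order (B ⊞* replicate n C) ↑ʳ b)) ∷ Vs , cong suc length≡
     , ≈-trans k (iso⇒≈ k (sumAssignSetRestrict (B ⊞* replicate n C) C X U))
                 (cong⊞ k p (≈-refl k (assignSet C (λ b → U (order (B ⊞* replicate n C) ↑ʳ b)) X)))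

assignSet-build : ∀ k B C X UB Vs → ∃ λ U →
                  assignSet (B ⊞* replicate (length Vs) C) U X ≈[ k ] assignSet B UB X ⊞* withSets C X Vs
assignSet-build k B C X UB [] = UB , ≈-refl k _
assignSet-build k B C X UB (V ∷ Vs) =
  let (U , p) = assignSet-build k B C X UB Vs
  in joinSet U V , ≈-trans k (iso⇒≈ k (sumAssignSet (B ⊞* replicate (length Vs) C) C U V X))
                             (cong⊞ k p (≈-refl k (assignSet C V X)))

Absent : ∀ {w} → Vec ℕ w → ℕ → Set
Absent W z = ∀ i → lookup W i ≢ z

Supported : ∀ {w} → Vec ℕ w → LStr → Set
Supported W C = ∀ z → Absent W z → place C z ≡ nothing × (∀ u → sets C z u ≡ false)

occurrence : ∀ {w} (W : Vec ℕ w) z → (∃ λ i → lookup W i ≡ z) ⊎ Absent W z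
occurrence []      z = inj₂ (λ ())
occurrence (y ∷ W) z with y ≟ z
... | yes y≡z = inj₁ (fzero , y≡z)
... | no  y≢z with occurrence W z
...   | inj₁ (i , eq) = inj₁ (fsuc i , eq)
...   | inj₂ absent   = inj₂ λ { fzero → y≢z ; (fsuc i) → absent i }

-- A name absent from W: larger than all of them.
fresh : ∀ {w} → Vec ℕ w → ℕ
fresh []      = 0
fresh (y ∷ W) = suc y + fresh W

fresh-absent : ∀ {w} (W : Vec ℕ w) → Absent W (fresh W)
fresh-absent W i eq = 1+n≰n (subst (λ n → suc n ≤ fresh W) eq (below W i))
  where
  below : ∀ {w} (W : Vec ℕ w) i → suc (lookup W i) ≤ fresh W
  below (y ∷ W) fzero    = m≤m+n (suc y) (fresh W)
  below (y ∷ W) (fsuc i) = ≤-trans (below W i) (m≤n+m (fresh W) (suc y))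

≢⇒≡ᵇ-false : ∀ {m n} → m ≢ n → (m ≡ᵇ n) ≡ false
≢⇒≡ᵇ-false {m} {n} m≢n with m ≡ᵇ n in eq
... | true  = ⊥-elim (m≢n (≡ᵇ⇒≡ m n (subst T (sym eq) tt)))
... | false = refl

≡ᵇ-refl : ∀ n → (n ≡ᵇ n) ≡ true
≡ᵇ-refl zero    = refl
≡ᵇ-refl (suc n) = ≡ᵇ-refl n

module _ {w} (W : Vec ℕ w) (C : LStr) (x : ℕ) (supported : Supported W C) where
  private
    other : ∀ z → Absent (x ∷ W) z → (z ≡ᵇ x) ≡ false
    other z absent = ≢⇒≡ᵇ-false (λ z≡x → absent fzero (sym z≡x))

  supported-assign : ∀ v → Supported (x ∷ W) (assign C v x)
  supported-assign v z absent rewrite other z absent = supported z (λ i → absent (fsuc i))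

  supported-unassign : Supported (x ∷ W) (unassign C x)
  supported-unassign z absent rewrite other z absent = supported z (λ i → absent (fsuc i))

  supported-assignSet : ∀ U → Supported (x ∷ W) (assignSet C U x)
  supported-assignSet U z absent rewrite other z absent = supported z (λ i → absent (fsuc i))

rename : (ℕ → ℕ) → LStr → LStr
rename σ L = lstr (graphOf L) (λ y → place L (σ y)) (λ Y → sets L (σ Y))

module _ (σ : ℕ → ℕ) (σ-injective : ∀ {a b} → σ a ≡ σ b → a ≡ b) where
  private
    σ-≡ᵇ : ∀ y x → (σ y ≡ᵇ σ x) ≡ (y ≡ᵇ x)
    σ-≡ᵇ y x with y ≟ x
    ... | yes refl = trans (≡ᵇ-refl (σ y)) (sym (≡ᵇ-refl y))
    ... | no  y≢x  = trans (≢⇒≡ᵇ-false (λ eq → y≢x (σ-injective eq))) (sym (≢⇒≡ᵇ-false y≢x))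

  rename-assign : ∀ C v x → Iso (assign (rename σ C) v x) (rename σ (assign C v (σ x)))
  rename-assign C v x = relabel (λ y → cong (λ b → if b then just v else place C (σ y)) (σ-≡ᵇ y x)) (λ _ _ → refl)

  rename-unassign : ∀ C x → Iso (unassign (rename σ C) x) (rename σ (unassign C (σ x)))
  rename-unassign C x = relabel (λ y → cong (λ b → if b then nothing else place C (σ y)) (σ-≡ᵇ y x)) (λ _ _ → refl)

  rename-assignSet : ∀ C U X → Iso (assignSet (rename σ C) U X) (rename σ (assignSet C U (σ X)))
  rename-assignSet C U X = relabel (λ _ → refl) (λ Y u → cong (λ b → (if b then U else sets C (σ Y)) u) (σ-≡ᵇ Y X))

  rename-≈ : ∀ k {C D} → C ≈[ k ] D → rename σ C ≈[ k ] rename σ D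
  rename-≈ zero (e , a , m) = (λ x y → e (σ x) (σ y)) , (λ x → a (σ x)) , (λ x X → m (σ x) (σ X))
  rename-≈ (suc k) {C} {D} p =
    (λ x → ( (λ v → let (w , q) = forth₁ p (σ x) v in
                     w , ≈-via-iso k (rename-assign C v x) (rename-≈ k q) (rename-assign D w x))
           , (λ w → let (v , q) = back₁ p (σ x) w in
                     v , ≈-via-iso k (rename-assign C v x) (rename-≈ k q) (rename-assign D w x)))
           , ≈-via-iso k (rename-unassign C x) (rename-≈ k (unassign≈ p (σ x))) (rename-unassign D x))
    , (λ X → (λ U → let (U' , q) = forth₂ p (σ X) U in
                     U' , ≈-via-iso k (rename-assignSet C U X) (rename-≈ k q) (rename-assignSet D U' X))
           , (λ U' → let (U , q) = back₂ p (σ X) U' in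
                     U , ≈-via-iso k (rename-assignSet C U X) (rename-≈ k q) (rename-assignSet D U' X)))

pickName : (a b z : ℕ) → Dec (z ≡ a) → Dec (z ≡ b) → ℕ
pickName a b z (yes _) _       = b
pickName a b z (no _)  (yes _) = a
pickName a b z (no _)  (no _)  = z

transpose : ℕ → ℕ → ℕ → ℕ
transpose a b z = pickName a b z (z ≟ a) (z ≟ b)

data TranspositionView (a b z : ℕ) : Set where
  is-a  : z ≡ a → transpose a b z ≡ b → TranspositionView a b z
  is-b  : z ≡ b → transpose a b z ≡ a → TranspositionView a b z
  other : z ≢ a → z ≢ b → transpose a b z ≡ z → TranspositionView a b z

transpositionView : ∀ a b z → TranspositionView a b z
transpositionView a b z = view (z ≟ a) (z ≟ b) refl
  where
  view : ∀ da db → transpose a b z ≡ pickName a b z da db → TranspositionView a b z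
  view (yes z≡a) _         eq = is-a z≡a eq
  view (no z≢a)  (yes z≡b) eq = is-b z≡b eq
  view (no z≢a)  (no z≢b)  eq = other z≢a z≢b eq

transpose-b : ∀ a b → transpose a b b ≡ a
transpose-b a b with transpositionView a b b
... | is-a b≡a eq     = trans eq b≡a
... | is-b _ eq       = eq
... | other _ b≢b _   = ⊥-elim (b≢b refl)

transpose-involutive : ∀ a b z → transpose a b (transpose a b z) ≡ z
transpose-involutive a b z with transpositionView a b z
... | is-a refl eq rewrite eq = transpose-b a b
... | is-b refl eq rewrite eq with transpositionView a b a
...   | is-a _ eq'       = eq'
...   | is-b a≡b eq'     = trans eq' a≡b
...   | other a≢a _ _    = ⊥-elim (a≢a refl)
transpose-involutive a b z | other _ _ eq rewrite eq = eq

transpose-injective : ∀ a b {y z} → transpose a b y ≡ transpose a b z → y ≡ z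
transpose-injective a b {y} {z} eq =
  trans (sym (transpose-involutive a b y)) (trans (cong (transpose a b) eq) (transpose-involutive a b z))

transpose-supported : ∀ {w} (W : Vec ℕ w) a b C → Absent W a → Absent W b → Supported W C →
                      Iso C (rename (transpose a b) C)
transpose-supported W a b C absent-a absent-b supported = relabel placed coloured
  where
  placed : ∀ y → place C (transpose a b y) ≡ place C y
  placed y with transpositionView a b y
  ... | is-a refl eq rewrite eq = trans (proj₁ (supported b absent-b)) (sym (proj₁ (supported a absent-a)))
  ... | is-b refl eq rewrite eq = trans (proj₁ (supported a absent-a)) (sym (proj₁ (supported b absent-b)))
  ... | other _ _ eq rewrite eq = refl
  coloured : ∀ Y u → sets C (transpose a b Y) u ≡ sets C Y u
  coloured Y u with transpositionView a b Y
  ... | is-a refl eq rewrite eq = trans (proj₂ (supported b absent-b) u) (sym (proj₂ (supported a absent-a) u))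
  ... | is-b refl eq rewrite eq = trans (proj₂ (supported a absent-a) u) (sym (proj₂ (supported b absent-b) u))
  ... | other _ _ eq rewrite eq = refl

-- For structures supported by W, the k-round game is decided by a
-- finite amount of information, the code: the answers to finitely many tests.
-- Tests refer to names by their index in W; at level k+1 the index 0 refers
-- to the fresh name, which stands for all names absent from W.

Code : Set
Code = List (Maybe Bool)

_≟ᶜ_ : DecidableEquality Code
_≟ᶜ_ = ≡-decᴸ (≡-decᴹ _≟ᴮ_)

matches : Code → Code → Bool
matches c c' = ⌊ c ≟ᶜ c' ⌋

answers : List (Maybe Bool)
answers = nothing ∷ just true ∷ just false ∷ []

answer∈ : ∀ a → a ∈ answers
answer∈ nothing      = here refl
answer∈ (just true)  = there (here refl)
answer∈ (just false) = there (there (here refl))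

allCodes : ℕ → List Code
allCodes zero    = [] ∷ []
allCodes (suc n) = cartesianProductWith _∷_ answers (allCodes n)

allCodes-complete : ∀ c → c ∈ allCodes (length c)
allCodes-complete []      = here refl
allCodes-complete (a ∷ c) = ∈-cartesianProductWith⁺ _∷_ (answer∈ a) (allCodes-complete c)

allSets : ∀ n → List (Fin n → Bool)
allSets zero    = (λ ()) ∷ []
allSets (suc n) = cartesianProductWith Vector._∷_ (true ∷ false ∷ []) (allSets n)

allSets-complete : ∀ {n} (U : Fin n → Bool) → ∃ λ U' → U' ∈ allSets n × (∀ i → U' i ≡ U i)
allSets-complete {zero}  U = _ , here refl , λ ()
allSets-complete {suc n} U =
  let (U' , U'∈ , U'≗) = allSets-complete (λ i → U (fsuc i))
  in Vector._∷_ (U fzero) U' , ∈-cartesianProductWith⁺ Vector._∷_ (bool∈ (U fzero)) U'∈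
     , λ { fzero → refl ; (fsuc i) → U'≗ i }
  where
  bool∈ : ∀ b → b ∈ true ∷ false ∷ []
  bool∈ true  = here refl
  bool∈ false = there (here refl)

data AtomicTest (w : ℕ) : Set where
  edgeTest     : Fin w → Fin w → AtomicTest w
  attachedTest : Fin w → AtomicTest w
  memberTest   : Fin w → Fin w → AtomicTest w

data Kind : Set where
  point forget set : Kind

allKinds : List Kind
allKinds = point ∷ forget ∷ set ∷ []

kind∈ : ∀ κ → κ ∈ allKinds
kind∈ point  = here refl
kind∈ forget = there (here refl)
kind∈ set    = there (there (here refl))

-- Tests at level k+1: a name index, a code at level k, and a kind of move;
-- the test asks whether some move of that kind at that name yields the code.
Test : ℕ → ℕ → Set
Test zero    w = AtomicTest w
Test (suc k) w = Fin (suc w) × Code × Kind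

allPairs : ∀ w → List (Fin w × Fin w)
allPairs w = cartesianProduct (allFin w) (allFin w)

tests : ∀ k w → List (Test k w)
tests zero w = map (λ (i , j) → edgeTest i j) (allPairs w)
            ++ map attachedTest (allFin w)
            ++ map (λ (i , j) → memberTest i j) (allPairs w)
tests (suc k) w =
  cartesianProduct (allFin (suc w)) (cartesianProduct (allCodes (length (tests k (suc w)))) allKinds)

edgeTest∈ : ∀ {w} (i j : Fin w) → edgeTest i j ∈ tests zero w
edgeTest∈ i j = ∈-++⁺ˡ (∈-map⁺ _ (∈-cartesianProduct⁺ (∈-allFin i) (∈-allFin j)))

attachedTest∈ : ∀ {w} (i : Fin w) → attachedTest i ∈ tests zero w
attachedTest∈ {w} i = ∈-++⁺ʳ (map _ (allPairs w)) (∈-++⁺ˡ (∈-map⁺ attachedTest (∈-allFin i)))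

memberTest∈ : ∀ {w} (i j : Fin w) → memberTest i j ∈ tests zero w
memberTest∈ {w} i j = ∈-++⁺ʳ (map _ (allPairs w)) (∈-++⁺ʳ (map attachedTest (allFin w))
                        (∈-map⁺ _ (∈-cartesianProduct⁺ (∈-allFin i) (∈-allFin j))))

eval : ∀ k {w} → Vec ℕ w → LStr → Test k w → Maybe Bool
code : ∀ k {w} → Vec ℕ w → LStr → Code

movePossible : ∀ k {w} → Vec ℕ w → LStr → ℕ → Code → Kind → Bool
movePossible k W C x c point  = any (λ v → matches (code k (x ∷ W) (assign C v x)) c) (allFin (order C))
movePossible k W C x c forget = matches (code k (x ∷ W) (unassign C x)) c
movePossible k W C x c set    = any (λ U → matches (code k (x ∷ W) (assignSet C U x)) c) (allSets (order C))

eval zero W C (edgeTest i j)   = edgeAt C (lookup W i) (lookup W j)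
eval zero W C (attachedTest i) = attachedAt C (lookup W i)
eval zero W C (memberTest i j) = memberAt C (lookup W i) (lookup W j)
eval (suc k) W C (i , c , κ)   = just (movePossible k W C (lookup (fresh W ∷ W) i) c κ)

code k {w} W C = map (eval k W C) (tests k w)

codeCount : ℕ → ℕ → ℕ
codeCount k w = length (allCodes (length (tests k w)))

code∈allCodes : ∀ k {w} (W : Vec ℕ w) C → code k W C ∈ allCodes (length (tests k w))
code∈allCodes k {w} W C = subst (λ n → code k W C ∈ allCodes n) (length-map (eval k W C) (tests k w)) (allCodes-complete _)

map-≡-∈ : ∀ {A B : Set} {f g : A → B} xs → map f xs ≡ map g xs → ∀ {a} → a ∈ xs → f a ≡ g a
map-≡-∈ (x ∷ xs) eq (here refl) = proj₁ (∷-injective eq)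
map-≡-∈ (x ∷ xs) eq (there a∈)  = map-≡-∈ xs (proj₂ (∷-injective eq)) a∈

witness : ∀ {A B : Set} (f : A → Code) (g : B → Code) {xs ys c} →
          any (λ a → matches (f a) c) xs ≡ any (λ b → matches (g b) c) ys →
          ∀ {a} → a ∈ xs → f a ≡ c → ∃ λ b → g b ≡ c
witness f g {ys = ys} eq a∈ fa≡c =
  let (b , matching) = satisfied (any⁻ _ ys (subst T eq (any⁺ _ (lose a∈ (fromWitness fa≡c)))))
  in b , toWitness matching

edgeBetween-nothing : ∀ G m → edgeBetween G m nothing ≡ nothing
edgeBetween-nothing G (just _) = refl
edgeBetween-nothing G nothing  = refl

member-empty : ∀ {a b} (m : Maybe (Fin a)) (m' : Maybe (Fin b)) {f : Fin a → Bool} {f' : Fin b → Bool}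
               (g : Fin a → Bool) (g' : Fin b → Bool) → (∀ u → g u ≡ false) → (∀ u → g' u ≡ false) →
               mapᴹ f m ≡ mapᴹ f' m' → mapᴹ g m ≡ mapᴹ g' m'
member-empty (just u) (just u') g g' empty empty' _ = cong just (trans (empty u) (sym (empty' u')))
member-empty nothing  nothing   g g' empty empty' _ = refl

sound₀ : ∀ {w} (W : Vec ℕ w) C D → Supported W C → Supported W D → code zero W C ≡ code zero W D → C ≈[ zero ] D
sound₀ {w} W C D sC sD eq = sameEdges , sameAttached , sameMember
  where
  agree : ∀ {t} → t ∈ tests zero w → eval zero W C t ≡ eval zero W D t
  agree = map-≡-∈ (tests zero w) eq
  sameEdges : ∀ x y → edgeAt C x y ≡ edgeAt D x y
  sameEdges x y with occurrence W x | occurrence W y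
  ... | inj₂ absent | _ rewrite proj₁ (sC x absent) | proj₁ (sD x absent) = refl
  ... | inj₁ _ | inj₂ absent rewrite proj₁ (sC y absent) | proj₁ (sD y absent) =
    trans (edgeBetween-nothing (graphOf C) (place C x)) (sym (edgeBetween-nothing (graphOf D) (place D x)))
  ... | inj₁ (i , refl) | inj₁ (j , refl) = agree (edgeTest∈ i j)
  sameAttached : ∀ x → attachedAt C x ≡ attachedAt D x
  sameAttached x with occurrence W x
  ... | inj₂ absent rewrite proj₁ (sC x absent) | proj₁ (sD x absent) = refl
  ... | inj₁ (i , refl) = agree (attachedTest∈ i)
  sameMember : ∀ x X → memberAt C x X ≡ memberAt D x X
  sameMember x X with occurrence W x | occurrence W X
  ... | inj₂ absent | _ rewrite proj₁ (sC x absent) | proj₁ (sD x absent) = refl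
  ... | inj₁ (i , refl) | inj₂ absent =
    member-empty (place C x) (place D x) (sets C X) (sets D X) (proj₂ (sC X absent)) (proj₂ (sD X absent))
                 (agree (attachedTest∈ i))
  ... | inj₁ (i , refl) | inj₁ (j , refl) = agree (memberTest∈ i j)

module SoundStep (k : ℕ)
  (soundₖ : ∀ {w} (W : Vec ℕ w) C D → Supported W C → Supported W D → code k W C ≡ code k W D → C ≈[ k ] D)
  {w} (W : Vec ℕ w) where

  name : Fin (suc w) → ℕ
  name i = lookup (fresh W ∷ W) i

  SameCode : LStr → LStr → Set
  SameCode C D = code (suc k) W C ≡ code (suc k) W D

  answer : ∀ {C D} → SameCode C D → ∀ i {c} κ → c ∈ allCodes (length (tests k (suc w))) →
           eval (suc k) W C (i , c , κ) ≡ eval (suc k) W D (i , c , κ)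
  answer eq i κ c∈ =
    map-≡-∈ (tests (suc k) w) eq (∈-cartesianProduct⁺ (∈-allFin i) (∈-cartesianProduct⁺ c∈ (kind∈ κ)))

  pointAt : ∀ {C D} → Supported W C → Supported W D → SameCode C D →
            ∀ i v → ∃ λ u → assign C v (name i) ≈[ k ] assign D u (name i)
  pointAt {C} {D} sC sD eq i v =
    let x = name i
        (u , same) = witness (λ v' → code k (x ∷ W) (assign C v' x)) (λ u' → code k (x ∷ W) (assign D u' x))
                       {ys = allFin (order D)}
                       (just-injective (answer eq i point (code∈allCodes k (x ∷ W) (assign C v x)))) (∈-allFin v) refl
    in u , soundₖ (x ∷ W) (assign C v x) (assign D u x) (supported-assign W C x sC v) (supported-assign W D x sD u) (sym same)

  forgetAt : ∀ {C D} → Supported W C → Supported W D → SameCode C D →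
             ∀ i → unassign C (name i) ≈[ k ] unassign D (name i)
  forgetAt {C} {D} sC sD eq i =
    let x = name i
        c = code k (x ∷ W) (unassign C x)
        same = toWitness (subst T (just-injective (answer eq i forget (code∈allCodes k (x ∷ W) (unassign C x))))
                                  (fromWitness {a? = c ≟ᶜ c} refl))
    in soundₖ (x ∷ W) (unassign C x) (unassign D x) (supported-unassign W C x sC) (supported-unassign W D x sD) (sym same)

  setAt : ∀ {C D} → Supported W C → Supported W D → SameCode C D →
          ∀ i U → ∃ λ U' → assignSet C U (name i) ≈[ k ] assignSet D U' (name i)
  setAt {C} {D} sC sD eq i U =
    let x = name i
        (U₀ , U₀∈ , U₀≗U) = allSets-complete U
        (U' , same) = witness (λ V → code k (x ∷ W) (assignSet C V x)) (λ V → code k (x ∷ W) (assignSet D V x))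
                        {ys = allSets (order D)}
                        (just-injective (answer eq i set (code∈allCodes k (x ∷ W) (assignSet C U₀ x)))) U₀∈ refl
    in U' , ≈-trans k (iso⇒≈ k (isoAssignSet (isoRefl C) U U₀ x U₀≗U))
                      (soundₖ (x ∷ W) (assignSet C U₀ x) (assignSet D U' x)
                              (supported-assignSet W C x sC U₀) (supported-assignSet W D x sD U') (sym same))

  -- A name x absent from W behaves like the fresh name: transpose the two.
  module Absentee (x : ℕ) (absent : Absent W x) {C D} (sC : Supported W C) (sD : Supported W D) where
    σ : ℕ → ℕ
    σ = transpose (fresh W) x

    σ-injective : ∀ {a b} → σ a ≡ σ b → a ≡ b
    σ-injective = transpose-injective (fresh W) x

    σx : σ x ≡ fresh W
    σx = transpose-b (fresh W) x

    unrenamed : ∀ {L} → Supported W L → Iso L (rename σ L)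
    unrenamed {L} sL = transpose-supported W (fresh W) x L (fresh-absent W) absent sL

    pointMove : ∀ v u → assign C v (fresh W) ≈[ k ] assign D u (fresh W) → assign C v x ≈[ k ] assign D u x
    pointMove v u p = ≈-via-iso k (isoAssign (unrenamed sC) v v x refl)
      (≈-via-iso k (rename-assign σ σ-injective C v x)
         (subst (λ z → rename σ (assign C v z) ≈[ k ] rename σ (assign D u z)) (sym σx) (rename-≈ σ σ-injective k p))
         (rename-assign σ σ-injective D u x))
      (isoAssign (unrenamed sD) u u x refl)

    forgetMove : unassign C (fresh W) ≈[ k ] unassign D (fresh W) → unassign C x ≈[ k ] unassign D x
    forgetMove p = ≈-via-iso k (isoUnassign (unrenamed sC) x)
      (≈-via-iso k (rename-unassign σ σ-injective C x)
         (subst (λ z → rename σ (unassign C z) ≈[ k ] rename σ (unassign D z)) (sym σx) (rename-≈ σ σ-injective k p))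
         (rename-unassign σ σ-injective D x))
      (isoUnassign (unrenamed sD) x)

    setMove : ∀ U U' → assignSet C U (fresh W) ≈[ k ] assignSet D U' (fresh W) → assignSet C U x ≈[ k ] assignSet D U' x
    setMove U U' p = ≈-via-iso k (isoAssignSet (unrenamed sC) U U x (λ _ → refl))
      (≈-via-iso k (rename-assignSet σ σ-injective C U x)
         (subst (λ z → rename σ (assignSet C U z) ≈[ k ] rename σ (assignSet D U' z)) (sym σx)
                (rename-≈ σ σ-injective k p))
         (rename-assignSet σ σ-injective D U' x))
      (isoAssignSet (unrenamed sD) U' U' x (λ _ → refl))

  pointForth : ∀ {C D} → Supported W C → Supported W D → SameCode C D →
               ∀ x v → ∃ λ u → assign C v x ≈[ k ] assign D u x
  pointForth sC sD eq x v with occurrence W x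
  ... | inj₁ (i , refl) = pointAt sC sD eq (fsuc i) v
  ... | inj₂ absent = let (u , p) = pointAt sC sD eq fzero v in u , Absentee.pointMove x absent sC sD v u p

  setForth : ∀ {C D} → Supported W C → Supported W D → SameCode C D →
             ∀ X U → ∃ λ U' → assignSet C U X ≈[ k ] assignSet D U' X
  setForth sC sD eq X U with occurrence W X
  ... | inj₁ (i , refl) = setAt sC sD eq (fsuc i) U
  ... | inj₂ absent = let (U' , p) = setAt sC sD eq fzero U in U' , Absentee.setMove X absent sC sD U U' p

  forgetting : ∀ {C D} → Supported W C → Supported W D → SameCode C D → ∀ x → unassign C x ≈[ k ] unassign D x
  forgetting sC sD eq x with occurrence W x
  ... | inj₁ (i , refl) = forgetAt sC sD eq (fsuc i)
  ... | inj₂ absent = Absentee.forgetMove x absent sC sD (forgetAt sC sD eq fzero)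

  sound : ∀ {C D} → Supported W C → Supported W D → SameCode C D → C ≈[ suc k ] D
  sound sC sD eq =
    (λ x → ( pointForth sC sD eq x
           , (λ u → let (v , p) = pointForth sD sC (sym eq) x u in v , ≈-sym k p))
           , forgetting sC sD eq x)
    , (λ X → setForth sC sD eq X , (λ U' → let (U , p) = setForth sD sC (sym eq) X U' in U , ≈-sym k p))

sound : ∀ k {w} (W : Vec ℕ w) C D → Supported W C → Supported W D → code k W C ≡ code k W D → C ≈[ k ] D
sound zero    W C D = sound₀ W C D
sound (suc k) W C D = SoundStep.sound k (sound k) W

partitionBy : ∀ {A : Set} {P : A → Set} → (∀ a → Dec (P a)) → ∀ xs →
              ∃₂ λ ys zs → xs ↭ ys ++ zs × All P ys × All (λ a → ¬ P a) zs
partitionBy P? [] = [] , [] , ↭.refl , [] , []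
partitionBy P? (x ∷ xs) with partitionBy P? xs | P? x
... | ys , zs , perm , all-P , all-¬P | yes px = x ∷ ys , zs , ↭.prep x perm , px ∷ all-P , all-¬P
... | ys , zs , perm , all-P , all-¬P | no ¬px =
  ys , x ∷ zs , ↭-trans (↭.prep x perm) (↭-sym (shift x ys zs)) , all-P , ¬px ∷ all-¬P

pigeonhole : ∀ {A : Set} (cd : A → Code) M (P : List Code) xs → All (λ a → cd a ∈ P) xs →
             length P * M < length xs →
             ∃ λ c → ∃₂ λ same rest → xs ↭ same ++ rest × All (λ a → cd a ≡ c) same × M < length same
pigeonhole cd M [] [] [] ()
pigeonhole cd M (c ∷ P) xs codes bound with partitionBy (λ a → cd a ≟ᶜ c) xs
... | same , rest , perm , all-c , all-¬c with M <? length same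
...   | yes many = c , same , rest , perm , all-c , many
...   | no few =
  let (c' , same' , rest' , perm' , all-c' , many') = pigeonhole cd M P rest (others rest codesʳ all-¬c) restBound
  in c' , same' , same ++ rest' , ↭-trans perm (↭-trans (++⁺ˡ-↭ same perm') (shifts same same')) , all-c' , many'
  where
  codesʳ : All (λ a → cd a ∈ c ∷ P) rest
  codesʳ = ++⁻ʳ same (All-resp-↭ perm codes)
  others : ∀ zs → All (λ a → cd a ∈ c ∷ P) zs → All (λ a → ¬ cd a ≡ c) zs → All (λ a → cd a ∈ P) zs
  others [] [] [] = []
  others (_ ∷ zs) (here eq ∷ as) (ne ∷ nes) = ⊥-elim (ne eq)
  others (_ ∷ zs) (there m ∷ as) (_ ∷ nes)  = m ∷ others zs as nes
  restBound : length P * M < length rest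
  restBound = +-cancelˡ-< M _ _ (≤-trans bound (≤-trans (≤-reflexive (trans (↭-length perm) (length-++ same)))
                                                  (+-monoˡ-≤ (length rest) (≮⇒≥ few))))

⊞-unplaced₀ : ∀ Z C → Unplaced C → Z ⊞ C ≈[ zero ] Z
⊞-unplaced₀ Z C unplaced = sameEdges , sameAttached , sameMember
  where
  sameEdges : ∀ x y → edgeAt (Z ⊞ C) x y ≡ edgeAt Z x y
  sameEdges x y rewrite sumEdgeAt Z C x y | unplaced x | unplaced y with place Z x | place Z y
  ... | just _  | just _  = refl
  ... | just _  | nothing = refl
  ... | nothing | _       = refl
  sameAttached : ∀ x → attachedAt (Z ⊞ C) x ≡ attachedAt Z x
  sameAttached x rewrite sumAttachedAt Z C x | unplaced x with place Z x
  ... | just _  = refl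
  ... | nothing = refl
  sameMember : ∀ x X → memberAt (Z ⊞ C) x X ≡ memberAt Z x X
  sameMember x X rewrite sumMemberAt Z C x X | unplaced x with place Z x
  ... | just _  = refl
  ... | nothing = refl

⊞*-++ : ∀ B xs ys → B ⊞* (xs ++ ys) ≡ (B ⊞* ys) ⊞* xs
⊞*-++ B []       ys = refl
⊞*-++ B (x ∷ xs) ys = cong (_⊞ x) (⊞*-++ B xs ys)

-- The number of copies beyond which one more copy is not noticed in k
-- rounds, for copies supported by w names: enough for the induction
-- hypothesis after a point move, and for one colour class to exceed the
-- threshold at level k after a set move.
threshold : ℕ → ℕ → ℕ
threshold zero    w = 0
threshold (suc k) w = suc (threshold k w + codeCount k (suc w) * threshold k (suc w))

module AbsorbStep (k : ℕ)
  (absorbₖ : ∀ {w} (W : Vec ℕ w) B C → Unplaced C → Supported W C → ∀ r → threshold k w ≤ r →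
             B ⊞* replicate r C ≈[ k ] B ⊞* replicate (suc r) C)
  {w} (W : Vec ℕ w) (B C : LStr) (unplaced : Unplaced C) (supported : Supported W C)
  (r : ℕ) (bound : threshold (suc k) w ≤ suc r) where

  open ≈-Reasoning k

  copies : ℕ → List LStr
  copies n = replicate n C

  L R : LStr
  L = B ⊞* copies (suc r)
  R = B ⊞* copies (suc (suc r))

  a N₁ K : ℕ
  a  = threshold k w
  N₁ = threshold k (suc w)
  K  = codeCount k (suc w)

  a≤r : a ≤ r
  a≤r = ≤-trans (m≤m+n a (K * N₁)) (s≤s⁻¹ bound)

  enoughCopies : K * N₁ < suc r
  enoughCopies = s≤s (≤-trans (m≤n+m (K * N₁) a) (s≤s⁻¹ bound))

  grow : ∀ Z n → a ≤ n → Z ⊞* copies n ≈[ k ] Z ⊞* copies (suc n)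
  grow Z n = absorbₖ W Z C unplaced supported n

  allUnplaced : ∀ n → All Unplaced (copies n)
  allUnplaced n = replicate⁺ n unplaced

  -- A vertex in the base is answered by the same vertex, one in a copy by
  -- a vertex in the copy next to the base.
  pointForth : ∀ x v → ∃ λ u → assign L v x ≈[ k ] assign R u x
  pointForth x v with locate k B C unplaced r v x
  ... | inj₁ (b , p) = inBase B (copies (suc (suc r))) b , (begin
    assign L v x                          ≈⟨ p ⟩
    assign B b x ⊞* copies (suc r)        ≈⟨ grow (assign B b x) (suc r) (m≤n⇒m≤1+n a≤r) ⟩
    assign B b x ⊞* copies (suc (suc r))  ≈⟨ assign-inBase k B b x (allUnplaced (suc (suc r))) ⟨
    assign R (inBase B (copies (suc (suc r))) b) x ∎)
  ... | inj₂ (c , p) = order (B ⊞* copies (suc r)) ↑ʳ c , (begin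
    assign L v x                                           ≈⟨ p ⟩
    (unassign B x ⊞ assign C c x) ⊞* copies r              ≈⟨ grow (unassign B x ⊞ assign C c x) r a≤r ⟩
    (unassign B x ⊞ assign C c x) ⊞* copies (suc r)        ≈⟨ assign-inCopy k B C c x (allUnplaced (suc r)) ⟨
    assign R (order (B ⊞* copies (suc r)) ↑ʳ c) x          ∎)

  pointBack : ∀ x u → ∃ λ v → assign L v x ≈[ k ] assign R u x
  pointBack x u with locate k B C unplaced (suc r) u x
  ... | inj₁ (b , p) = inBase B (copies (suc r)) b , (begin
    assign L (inBase B (copies (suc r)) b) x  ≈⟨ assign-inBase k B b x (allUnplaced (suc r)) ⟩
    assign B b x ⊞* copies (suc r)            ≈⟨ grow (assign B b x) (suc r) (m≤n⇒m≤1+n a≤r) ⟩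
    assign B b x ⊞* copies (suc (suc r))      ≈⟨ p ⟨
    assign R u x                              ∎)
  ... | inj₂ (c , p) = order (B ⊞* copies r) ↑ʳ c , (begin
    assign L (order (B ⊞* copies r) ↑ʳ c) x          ≈⟨ assign-inCopy k B C c x (allUnplaced r) ⟩
    (unassign B x ⊞ assign C c x) ⊞* copies r        ≈⟨ grow (unassign B x ⊞ assign C c x) r a≤r ⟩
    (unassign B x ⊞ assign C c x) ⊞* copies (suc r)  ≈⟨ p ⟨
    assign R u x                                     ∎)

  forgetting : ∀ x → unassign L x ≈[ k ] unassign R x
  forgetting x = begin
    unassign L x                          ≈⟨ unassign-⊞* k B x (allUnplaced (suc r)) ⟩
    unassign B x ⊞* copies (suc r)        ≈⟨ grow (unassign B x) (suc r) (m≤n⇒m≤1+n a≤r) ⟩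
    unassign B x ⊞* copies (suc (suc r))  ≈⟨ unassign-⊞* k B x (allUnplaced (suc (suc r))) ⟨
    unassign R x                          ∎

  -- Set moves: the sets chosen on the copies fall into at most K classes,
  -- so some class is large, and one more member of it goes unnoticed.
  module _ (X : ℕ) where
    -- the colour of a set V: the code of the copy with X assigned to V
    cd : (Fin (order C) → Bool) → Code
    cd V = code k (X ∷ W) (assignSet C V X)

    ws : List (Fin (order C) → Bool) → List LStr
    ws = withSets C X

    insertCopy : ∀ Y V₀ Vs → All (λ V → cd V ≡ cd V₀) Vs → N₁ ≤ length Vs →
                 Y ⊞* ws Vs ≈[ k ] Y ⊞* ws (V₀ ∷ Vs)
    insertCopy Y V₀ Vs same enough = begin
      Y ⊞* ws Vs                        ≈⟨ ⊞*-cong k (≈-refl k Y) (towardsD Vs same) ⟩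
      Y ⊞* replicate (length Vs) D       ≈⟨ absorbₖ (X ∷ W) Y D unplaced supportedD (length Vs) enough ⟩
      Y ⊞* replicate (suc (length Vs)) D ≈⟨ ⊞*-cong k (≈-refl k Y) (towardsD (V₀ ∷ Vs) (refl ∷ same)) ⟨
      Y ⊞* ws (V₀ ∷ Vs)                 ∎
      where
      D = assignSet C V₀ X
      supportedD = supported-assignSet W C X supported V₀
      towardsD : ∀ Vs → All (λ V → cd V ≡ cd V₀) Vs → Pointwise _≈[ k ]_ (ws Vs) (replicate (length Vs) D)
      towardsD []       []         = []
      towardsD (V ∷ Vs) (eq ∷ eqs) =
        sound k (X ∷ W) (assignSet C V X) D (supported-assignSet W C X supported V) supportedD eq
        ∷ towardsD Vs eqs

    regroup : ∀ B' Vs rest → B' ⊞* ws (Vs ++ rest) ≡ (B' ⊞* ws rest) ⊞* ws Vs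
    regroup B' Vs rest = trans (cong (B' ⊞*_) (map-++ _ Vs rest)) (⊞*-++ B' (ws Vs) (ws rest))

    permuted : ∀ B' {Vs Vs'} → Vs ↭ Vs' → B' ⊞* ws Vs ≈[ k ] B' ⊞* ws Vs'
    permuted B' {Vs} perm = ⊞*-perm k B' (All-map⁺ (universal (λ _ → unplaced) Vs)) (↭-map⁺ _ perm)

    largeClass : ∀ Vs → K * N₁ < length Vs →
                 ∃ λ V₀ → ∃₂ λ same rest →
                   Vs ↭ (V₀ ∷ same) ++ rest × All (λ V → cd V ≡ cd V₀) same × N₁ ≤ length same
    largeClass Vs big
      with pigeonhole cd N₁ (allCodes (length (tests k (suc w)))) Vs
             (universal (λ V → code∈allCodes k (X ∷ W) (assignSet C V X)) Vs) big
    ... | c , V₀ ∷ same , rest , perm , cdV₀ ∷ cdSame , many =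
      V₀ , same , rest , perm , mapAll cdSame , s≤s⁻¹ many
      where
      mapAll : ∀ {Vs} → All (λ V → cd V ≡ c) Vs → All (λ V → cd V ≡ cd V₀) Vs
      mapAll []         = []
      mapAll (eq ∷ eqs) = trans eq (sym cdV₀) ∷ mapAll eqs

    built : ∀ UB Vs n → length Vs ≡ n → ∃ λ U → assignSet (B ⊞* copies n) U X ≈[ k ] assignSet B UB X ⊞* ws Vs
    built UB Vs n refl = assignSet-build k B C X UB Vs

    setForth : ∀ U → ∃ λ U' → assignSet L U X ≈[ k ] assignSet R U' X
    setForth U =
      let (UB , Vs , length≡ , p) = assignSet-split k B C (suc r) X U
          (V₀ , same , rest , perm , sameClass , enough) = largeClass Vs (subst (K * N₁ <_) (sym length≡) enoughCopies)
          B' = assignSet B UB X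
          Y = B' ⊞* ws rest
          (U' , q) = built UB (V₀ ∷ Vs) (suc (suc r)) (cong suc length≡)
      in U' , (begin
        assignSet L U X                   ≈⟨ p ⟩
        B' ⊞* ws Vs                       ≈⟨ permuted B' perm ⟩
        B' ⊞* ws ((V₀ ∷ same) ++ rest)     ≡⟨ regroup B' (V₀ ∷ same) rest ⟩
        Y ⊞* ws (V₀ ∷ same)               ≈⟨ insertCopy Y V₀ (V₀ ∷ same) (refl ∷ sameClass) (m≤n⇒m≤1+n enough) ⟩
        Y ⊞* ws (V₀ ∷ V₀ ∷ same)          ≡⟨ regroup B' (V₀ ∷ V₀ ∷ same) rest ⟨
        B' ⊞* ws ((V₀ ∷ V₀ ∷ same) ++ rest) ≈⟨ permuted B' (↭.prep V₀ (↭-sym perm)) ⟩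
        B' ⊞* ws (V₀ ∷ Vs)                ≈⟨ q ⟨
        assignSet R U' X                  ∎)

    setBack : ∀ U' → ∃ λ U → assignSet L U X ≈[ k ] assignSet R U' X
    setBack U' =
      let (UB , Vs , length≡ , p) = assignSet-split k B C (suc (suc r)) X U'
          (V₀ , same , rest , perm , sameClass , enough) =
            largeClass Vs (subst (K * N₁ <_) (sym length≡) (m≤n⇒m≤1+n enoughCopies))
          B' = assignSet B UB X
          Y = B' ⊞* ws rest
          (U , q) = built UB (same ++ rest) (suc r) (suc-injective (trans (sym (↭-length perm)) length≡))
      in U , (begin
        assignSet L U X                 ≈⟨ q ⟩
        B' ⊞* ws (same ++ rest)         ≡⟨ regroup B' same rest ⟩
        Y ⊞* ws same                    ≈⟨ insertCopy Y V₀ same sameClass enough ⟩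
        Y ⊞* ws (V₀ ∷ same)             ≡⟨ regroup B' (V₀ ∷ same) rest ⟨
        B' ⊞* ws ((V₀ ∷ same) ++ rest)   ≈⟨ permuted B' (↭-sym perm) ⟩
        B' ⊞* ws Vs                     ≈⟨ p ⟨
        assignSet R U' X                ∎)

  absorbed : L ≈[ suc k ] R
  absorbed = (λ x → (pointForth x , pointBack x) , forgetting x) , (λ X → setForth X , setBack X)

absorb : ∀ k {w} (W : Vec ℕ w) B C → Unplaced C → Supported W C → ∀ r → threshold k w ≤ r →
         B ⊞* replicate r C ≈[ k ] B ⊞* replicate (suc r) C
absorb zero    W B C unplaced supported r       _     = ≈-sym zero (⊞-unplaced₀ (B ⊞* replicate r C) C unplaced)
absorb (suc k) W B C unplaced supported (suc r) bound = AbsorbStep.absorbed k (absorb k) W B C unplaced supported r bound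

-- Back to the structures of the statement.  A structure with a chosen set
-- of attached vertices is a labelled structure; unassigned second-order
-- variables become empty sets.
valS : (T : Structure) → ℕ → Fin (size T) → Bool
valS T X v = maybe′ (λ U → U v) false (val₂ T X)

asLStr : (T : Structure) → (Fin (size T) → Bool) → LStr
asLStr T a = lstr (graph (size T) (edge T) a) (val₁ T) (valS T)

assignSet-asLStr : ∀ T a U X → Iso (asLStr (T [ U /₂ X ]) a) (assignSet (asLStr T a) U X)
assignSet-asLStr T a U X = relabel (λ _ → refl) coloured
  where
  coloured : ∀ Y v → (if Y ≡ᵇ X then U else valS T Y) v
                     ≡ maybe′ (λ V → V v) false (if Y ≡ᵇ X then just U else val₂ T Y)
  coloured Y v with Y ≡ᵇ X
  ... | true  = refl
  ... | false = refl

is-just⇒≡ : ∀ {A : Set} {m : Maybe A} → Is-just m → ∃ λ a → m ≡ just a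
is-just⇒≡ (is-just {x = a} _) = a , refl

module Atomic {T T' a a'} (agree : Agree₀ (asLStr T a) (asLStr T' a')) where
  member : ∀ x X → Is-just (val₁ T' x) → Is-just (val₂ T' X) → T ⊨ mem x X → T' ⊨ mem x X
  member x X placed' set' (v , U , eqv , eqU , Uv) =
    let (v' , eqv') = is-just⇒≡ placed'
        (U' , eqU') = is-just⇒≡ set'
        same : just (U v) ≡ just (U' v')
        same = begin
          just (U v)                         ≡⟨ cong (λ m → just (maybe′ (λ V → V v) false m)) eqU ⟨
          mapᴹ (valS T X) (just v)           ≡⟨ cong (mapᴹ (valS T X)) eqv ⟨
          memberAt (asLStr T a) x X          ≡⟨ proj₂ (proj₂ agree) x X ⟩
          memberAt (asLStr T' a') x X        ≡⟨ cong (mapᴹ (valS T' X)) eqv' ⟩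
          mapᴹ (valS T' X) (just v')         ≡⟨ cong (λ m → just (maybe′ (λ V → V v') false m)) eqU' ⟩
          just (U' v')                       ∎
    in v' , U' , eqv' , eqU' , trans (sym (just-injective same)) Uv
    where open ≡-Reasoning

  adjacent : ∀ x y → Is-just (val₁ T' x) → Is-just (val₁ T' y) → T ⊨ adj x y → T' ⊨ adj x y
  adjacent x y placedx' placedy' (u , v , equ , eqv , uv) =
    let (u' , equ') = is-just⇒≡ placedx'
        (v' , eqv') = is-just⇒≡ placedy'
        same : just (edge T u v) ≡ just (edge T' u' v')
        same = trans (cong₂ (edgeBetween (graphOf (asLStr T a))) (sym equ) (sym eqv))
                 (trans (proj₁ agree x y) (cong₂ (edgeBetween (graphOf (asLStr T' a'))) equ' eqv'))
    in u' , v' , equ' , eqv' , trans (sym (just-injective same)) uv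

transfer₀ : ∀ {T T' a a'} → Agree₀ (asLStr T a) (asLStr T' a') → Equiv₀ T T'
transfer₀ {T} {T'} {a} {a'} agree = satisfies
  where
  module Forth = Atomic {T} {T'} {a} {a'} agree
  module Back = Atomic {T'} {T} {a'} {a} (≈-sym zero agree)
  satisfies : ∀ φ → All (Interpreted T) (freeVars φ) → All (Interpreted T') (freeVars φ) →
              (T ⊨ φ → T' ⊨ φ) × (T' ⊨ φ → T ⊨ φ)
  satisfies (mem x X) (ix ∷ iX ∷ []) (ix' ∷ iX' ∷ []) = Forth.member x X ix' iX' , Back.member x X ix iX
  satisfies (adj x y) (ix ∷ iy ∷ []) (ix' ∷ iy' ∷ []) = Forth.adjacent x y ix' iy' , Back.adjacent x y ix iy
  satisfies (neg φ) i i' =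
    let (to , from) = satisfies φ i i' in (λ ¬φ φ' → ¬φ (from φ')) , (λ ¬φ' φ → ¬φ' (to φ))
  satisfies (conj φ ψ) i i' =
    let (toφ , fromφ) = satisfies φ (++⁻ˡ (freeVars φ) i) (++⁻ˡ (freeVars φ) i')
        (toψ , fromψ) = satisfies ψ (++⁻ʳ (freeVars φ) i) (++⁻ʳ (freeVars φ) i')
    in (λ (sφ , sψ) → toφ sφ , toψ sψ) , (λ (sφ , sψ) → fromφ sφ , fromψ sψ)
  satisfies (disj φ ψ) i i' =
    let (toφ , fromφ) = satisfies φ (++⁻ˡ (freeVars φ) i) (++⁻ˡ (freeVars φ) i')
        (toψ , fromψ) = satisfies ψ (++⁻ʳ (freeVars φ) i) (++⁻ʳ (freeVars φ) i')
    in [ (λ sφ → inj₁ (toφ sφ)) , (λ sψ → inj₂ (toψ sψ)) ]′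
       , [ (λ sφ → inj₁ (fromφ sφ)) , (λ sψ → inj₂ (fromψ sψ)) ]′

-- Equivalence of the labelled structures implies ≡[ k ].
transfer : ∀ k {T T'} a a' → asLStr T a ≈[ k ] asLStr T' a' → T ≡[ k ] T'
transfer zero    a a' p = transfer₀ p
transfer (suc k) {T} {T'} a a' p =
  (λ x → (λ v → let (v' , q) = forth₁ p x v in v' , transfer k a a' q)
       , (λ v' → let (v , q) = back₁ p x v' in v , transfer k a a' q))
  , (λ X → (λ U → let (U' , q) = forth₂ p X U in
                   U' , transfer k a a' (≈-via-iso k (assignSet-asLStr T a U X) q (assignSet-asLStr T' a' U' X)))
         , (λ U' → let (U , q) = back₂ p X U' in
                   U , transfer k a a' (≈-via-iso k (assignSet-asLStr T a U X) q (assignSet-asLStr T' a' U' X))))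

rooted : Structure → LStr
rooted T = asLStr T (isRoot T)

copyOf : Structure → LStr
copyOf S = lstr (graph (size S) (edge S) (isRoot S)) (λ _ → nothing) (valS S)

rootAt : ∀ {n} → Maybe (Fin n) → Fin n → Bool
rootAt (just r) v = ⌊ r ≟ᶠ v ⌋
rootAt nothing  v = false

isRoot-rootAt : ∀ T v → isRoot T v ≡ rootAt (val₁ T root) v
isRoot-rootAt T v with val₁ T root
... | just r  = refl
... | nothing = refl

rootAt-left : ∀ {m} n (r : Maybe (Fin m)) a → rootAt (mapᴹ (_↑ˡ n) r) (a ↑ˡ n) ≡ rootAt r a
rootAt-left n nothing  a = refl
rootAt-left n (just r) a with (r ↑ˡ n) ≟ᶠ (a ↑ˡ n) | r ≟ᶠ a
... | yes _  | yes _  = refl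
... | no _   | no _   = refl
... | yes eq | no r≢a = ⊥-elim (r≢a (↑ˡ-injective n r a eq))
... | no ne  | yes refl = ⊥-elim (ne refl)

rootAt-right : ∀ {m} n (r : Maybe (Fin m)) b → rootAt (mapᴹ (_↑ˡ n) r) (m ↑ʳ b) ≡ false
rootAt-right n nothing b = refl
rootAt-right {m} n (just r) b = trans (isYes≗does ((r ↑ˡ n) ≟ᶠ (m ↑ʳ b)))
                                      (dec-false ((r ↑ˡ n) ≟ᶠ (m ↑ʳ b)) disjoint)
  where
  disjoint : r ↑ˡ n ≢ m ↑ʳ b
  disjoint eq with trans (sym (splitAt-↑ˡ m r n)) (trans (cong (splitAt m) eq) (splitAt-↑ʳ m n b))
  ... | ()

module _ (T S : Structure) where
  joinSub-left : ∀ (m : Maybe (Subset (size T))) (m' : Maybe (Subset (size S))) a →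
                 maybe′ (λ U → U a) false m ≡ maybe′ (λ U → U (a ↑ˡ size S)) false (joinSub T S m m')
  joinSub-left (just U) (just _) a rewrite splitAt-↑ˡ (size T) a (size S) = refl
  joinSub-left (just U) nothing  a rewrite splitAt-↑ˡ (size T) a (size S) = refl
  joinSub-left nothing  (just _) a rewrite splitAt-↑ˡ (size T) a (size S) = refl
  joinSub-left nothing  nothing  a = refl

  joinSub-right : ∀ (m : Maybe (Subset (size T))) (m' : Maybe (Subset (size S))) b →
                  maybe′ (λ U → U b) false m' ≡ maybe′ (λ U → U (size T ↑ʳ b)) false (joinSub T S m m')
  joinSub-right (just _) (just U) b rewrite splitAt-↑ʳ (size T) (size S) b = refl
  joinSub-right (just _) nothing  b rewrite splitAt-↑ʳ (size T) (size S) b = refl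
  joinSub-right nothing  (just U) b rewrite splitAt-↑ʳ (size T) (size S) b = refl
  joinSub-right nothing  nothing  b = refl

unplaced-beyond-root : ∀ S → OnlyRootFO S → ∀ x → val₁ S (suc x) ≡ nothing
unplaced-beyond-root S onlyRoot x with val₁ S (suc x) in eq
... | nothing = refl
... | just v with onlyRoot (suc x) (subst Is-just (sym eq) (is-just tt))
...   | ()

attachIso : ∀ T S → OnlyRootFO S → Iso (rooted (T ⊕ S)) (rooted T ⊞ copyOf S)
attachIso T S onlyRoot = pointwiseIso sameEdges sameAttached samePlace sameSets
  where
  G = graphOf (rooted T)
  H = graphOf (copyOf S)
  crossEdges≡ : ∀ s t → crossEdges G H s t ≡ crossEdge T S s t
  crossEdges≡ (inj₁ a) (inj₁ a') = refl
  crossEdges≡ (inj₁ a) (inj₂ b)  = refl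
  crossEdges≡ (inj₂ b) (inj₁ a)  = refl
  crossEdges≡ (inj₂ b) (inj₂ b') = refl
  sameEdges : ∀ u v → edges (graphSum G H) u v ≡ edge (T ⊕ S) u v
  sameEdges u v = crossEdges≡ (splitAt (size T) u) (splitAt (size T) v)
  sameAttached : ∀ u → attached (graphSum G H) u ≡ isRoot (T ⊕ S) u
  sameAttached u with side (size T) (size S) u
  ... | left a = begin
    joinSet (isRoot T) (λ _ → false) (a ↑ˡ size S)             ≡⟨ joinSet-left (isRoot T) (λ _ → false) a ⟩
    isRoot T a                                                 ≡⟨ isRoot-rootAt T a ⟩
    rootAt (val₁ T root) a                                     ≡⟨ rootAt-left (size S) (val₁ T root) a ⟨
    rootAt (mapᴹ (_↑ˡ size S) (val₁ T root)) (a ↑ˡ size S)      ≡⟨ isRoot-rootAt (T ⊕ S) (a ↑ˡ size S) ⟨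
    isRoot (T ⊕ S) (a ↑ˡ size S)                               ∎
    where open ≡-Reasoning
  ... | right b = trans (joinSet-right (isRoot T) (λ _ → false) b)
                    (sym (trans (isRoot-rootAt (T ⊕ S) (size T ↑ʳ b)) (rootAt-right (size S) (val₁ T root) b)))
  samePlace : ∀ x → place (rooted T ⊞ copyOf S) x ≡ val₁ (T ⊕ S) x
  samePlace zero    = <∣>-identityʳ _
  samePlace (suc x) rewrite unplaced-beyond-root S onlyRoot x = refl
  sameSets : ∀ X u → joinSet (valS T X) (valS S X) u ≡ valS (T ⊕ S) X u
  sameSets X u with side (size T) (size S) u
  ... | left a  = trans (joinSet-left (valS T X) (valS S X) a) (joinSub-left T S (val₂ T X) (val₂ S X) a)
  ... | right b = trans (joinSet-right (valS T X) (valS S X) b) (joinSub-right T S (val₂ T X) (val₂ S X) b)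

represent : ∀ k S₀ S → OnlyRootFO S → ∀ p → rooted (S₀ ⊕[ p ] S) ≈[ k ] rooted S₀ ⊞* replicate p (copyOf S)
represent k S₀ S onlyRoot zero    = ≈-refl k (rooted S₀)
represent k S₀ S onlyRoot (suc p) =
  ≈-trans k (iso⇒≈ k (attachIso (S₀ ⊕[ p ] S) S onlyRoot))
            (cong⊞ k (represent k S₀ S onlyRoot p) (≈-refl k (copyOf S)))

nameOf : Var → ℕ
nameOf (fo x) = x
nameOf (so X) = X

names : (Ξ : List Var) → Vec ℕ (length (map nameOf Ξ))
names Ξ = fromList (map nameOf Ξ)

names-index : ∀ Ξ {v} → v ∈ Ξ → ∃ λ i → lookup (names Ξ) i ≡ nameOf v
names-index (_ ∷ Ξ) (here refl) = fzero , refl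
names-index (_ ∷ Ξ) (there v∈) = let (i , eq) = names-index Ξ v∈ in fsuc i , eq

copy-supported : ∀ Ξ S → VarsIn Ξ S → Supported (names Ξ) (copyOf S)
copy-supported Ξ S (_ , setsIn) z absent = refl , empty
  where
  empty : ∀ u → valS S z u ≡ false
  empty u with val₂ S z in eq
  ... | nothing = refl
  ... | just U  = let (i , eq') = names-index Ξ (setsIn z (subst Is-just (sym eq) (is-just tt))) in ⊥-elim (absent i eq')

saturated : ∀ k {w} (W : Vec ℕ w) B C → Unplaced C → Supported W C →
            ∀ p q → threshold k w ≤ p → threshold k w ≤ q → B ⊞* replicate p C ≈[ k ] B ⊞* replicate q C
saturated k {w} W B C unplaced supported p q t≤p t≤q = ≈-trans k (≈-sym k (fromThreshold p t≤p)) (fromThreshold q t≤q)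
  where
  t = threshold k w
  grown : ∀ d → B ⊞* replicate t C ≈[ k ] B ⊞* replicate (d + t) C
  grown zero    = ≈-refl k _
  grown (suc d) = ≈-trans k (grown d) (absorb k W B C unplaced supported (d + t) (m≤n+m t d))
  fromThreshold : ∀ n → t ≤ n → B ⊞* replicate t C ≈[ k ] B ⊞* replicate n C
  fromThreshold n t≤n =
    subst (λ n' → B ⊞* replicate t C ≈[ k ] B ⊞* replicate n' C) (m∸n+n≡m t≤n) (grown (n ∸ t))

proposition12 : (Ξ : List Var) (m : ℕ) →
    ∃ λ (qm : ℕ) →
      ∀ (S S₀ : Structure) →
        Rooted S → OnlyRootFO S → VarsIn Ξ S → Rooted S₀ →
        ∀ (p q : ℕ) → qm ≤ p → qm ≤ q →
        (S₀ ⊕[ p ] S) ≡[ m ] (S₀ ⊕[ q ] S)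
proposition12 Ξ m = threshold m (length (map nameOf Ξ)) , λ S S₀ _ onlyRoot varsIn _ p q t≤p t≤q →
  transfer m (isRoot (S₀ ⊕[ p ] S)) (isRoot (S₀ ⊕[ q ] S)) (begin
    rooted (S₀ ⊕[ p ] S)                   ≈⟨ represent m S₀ S onlyRoot p ⟩
    rooted S₀ ⊞* replicate p (copyOf S)    ≈⟨ saturated m (names Ξ) (rooted S₀) (copyOf S) (λ _ → refl)
                                                         (copy-supported Ξ S varsIn) p q t≤p t≤q ⟩
    rooted S₀ ⊞* replicate q (copyOf S)    ≈⟨ represent m S₀ S onlyRoot q ⟨
    rooted (S₀ ⊕[ q ] S)                   ∎)
  where open ≈-Reasoning m
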